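{- Let $A$ be a finite alphabet and let $S\in\mathbb{Q}\langle\langle A\rangle\rangle$ be a cyclic formal power series with integer coefficients, i.e. $(S,w)\in\mathbb{Z}$ for all $w\in A^*$. Then its zeta function $\zeta_S$ has integer coefficients, i.e. $\zeta_S\in\mathbb{Z}[[t]]$.
   Context: $A^*$ is the free monoid of words on $A$ (including the empty word $1$), $A^+=A^*\setminus\{1\}$, and $|w|$ is the length of $w$. A series $S\in\mathbb{Q}\langle\langle A\rangle\rangle$ is written $S=\sum_{w\in A^*}(S,w)\,w$. It is cyclic if (i) $(S,uv)=(S,vu)$ for all $u,v\in A^*$, and (ii) $(S,w^r)=(S,w)^r$ for all $w\in A^+$ and all $r\geq2$. The zeta function of $S$ is $\zeta_S=\exp\big(\sum_{w\in A^+}(S,w)\,t^{|w|}/|w|\big)\in\mathbb{Q}[[t]]$. -}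

module Defs where

open import Data.Nat as ℕ using (ℕ; zero; suc; _!)
open import Data.Nat.Properties using (_!≢0)
open import Data.Integer as ℤ using (ℤ)
open import Data.Rational as ℚ using (ℚ; 0ℚ; 1ℚ; _+_; _*_; _/_)
open import Data.Fin using (Fin)
open import Data.List using (List; []; _∷_; _++_; map; concat; concatMap; replicate; allFin; sum; foldr; upTo; length)
open import Data.Product using (∃; _×_)
open import Relation.Binary.PropositionalEquality using (_≡_)

Word : ℕ → Set
Word k = List (Fin k)

-- A formal power series in ℚ⟨⟨A⟩⟩ is its coefficient function w ↦ (S,w).
Series : ℕ → Set
Series k = Word k → ℚ

-- Formal power series in one variable t over ℚ: coefficient functions.
PS : Set
PS = ℕ → ℚ

Σℚ : List ℚ → ℚ
Σℚ = foldr _+_ 0ℚ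

_^ℚ_ : ℚ → ℕ → ℚ
q ^ℚ zero  = 1ℚ
q ^ℚ suc r = q * (q ^ℚ r)

_^w_ : ∀ {k} → Word k → ℕ → Word k
w ^w r = concat (replicate r w)

wordsOfLength : (k n : ℕ) → List (Word k)
wordsOfLength k zero    = [] ∷ []
wordsOfLength k (suc n) = concatMap (λ a → map (a ∷_) (wordsOfLength k n)) (allFin k)

IsInteger : ℚ → Set
IsInteger q = ∃ λ (z : ℤ) → q ≡ z / 1

IntegerCoefficients : ∀ {k} → Series k → Set
IntegerCoefficients S = ∀ w → IsInteger (S w)

IsCyclic : ∀ {k} → Series k → Set
IsCyclic {k} S =
  (∀ (u v : Word k) → S (u ++ v) ≡ S (v ++ u)) ×
  (∀ (w : Word k) → length w ℕ.> 0 → ∀ (r : ℕ) → r ℕ.≥ 2 → S (w ^w r) ≡ S w ^ℚ r)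

_⊛_ : PS → PS → PS
(f ⊛ g) n = Σℚ (map (λ i → f i * g (n ℕ.∸ i)) (upTo (suc n)))

_^ps_ : PS → ℕ → PS
f ^ps zero  = λ { zero → 1ℚ ; (suc _) → 0ℚ }
f ^ps suc m = f ⊛ (f ^ps m)

-- exp of a power series with zero constant term: exp f = Σ_m f^m / m!.
-- Since f^m has order ≥ m, the n-th coefficient only involves m ≤ n.
expPS : PS → PS
expPS f n = Σℚ (map (λ m → (f ^ps m) n * (ℤ.+ 1 / (m !)) {{m !≢0}}) (upTo (suc n)))

logZeta : ∀ {k} → Series k → PS
logZeta S zero    = 0ℚ
logZeta {k} S (suc n) = Σℚ (map S (wordsOfLength k (suc n))) * (ℤ.+ 1 / suc n)

zeta : ∀ {k} → Series k → PS
zeta S = expPS (logZeta S)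

-- Let L = Σ_{w ≠ 1} (S,w) t^|w| / |w|, so that ζ_S = exp L. Every nonempty word is, in exactly one
-- way, the j-th rotation (j < |l|) of a power l^q of a Lyndon word l, and a cyclic S takes the value
-- (S,l)^q on each of these |l| rotations. Hence t L′ = Σ_l Σ_{q ≥ 1} |l| (S,l)^q t^{q|l|}, which is the
-- logarithmic derivative of P = Π_l 1/(1 − (S,l) t^|l|). Both ζ_S and P have constant term 1 and satisfy
-- t F′ = (t L′) F, a recursion that determines every coefficient; so ζ_S = P, and P ∈ ℤ[[t]] when S has
-- integer coefficients. Up to order n only the finitely many Lyndon words of length ≤ n matter.

module Submission where

open import Defs
open import Data.Nat as ℕ using (ℕ; zero; suc; _∸_; _≤_; _<_; z≤n; s≤s; _!)
import Data.Nat.Properties as ℕP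
open import Data.Nat.Properties using (_!≢0)
open import Data.Nat.Divisibility using (_∣_; divides; _∣?_; n∣m*n; ∣m+n∣m⇒∣n; ∣m∣n⇒∣m+n; ∣⇒≤; m%n≡0⇒n∣m)
open import Data.Nat.DivMod using (_/_; _%_; m*n/n≡m; m/n*n≡m; m≡m%n+[m/n]*n; m%n<n)
open import Data.Integer as ℤ using (ℤ)
import Data.Integer.Properties as ℤP
open import Data.Rational using (ℚ; 0ℚ; 1ℚ; _+_; _*_; toℚᵘ) renaming (_/_ to _÷_)
open import Data.Rational.Properties
import Data.Rational.Unnormalised as ℚᵘ
import Data.Rational.Unnormalised.Properties as ℚᵘP
open import Data.Rational.Solver using (module +-*-Solver)
open import Data.Fin as Fin using (Fin)
import Data.Fin.Properties as FinP
open import Function using (_∘_)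
open import Data.List using (List; []; _∷_; _++_; length; take; drop; map; concatMap; tabulate; allFin; upTo; applyUpTo)
open import Data.List.Properties
  using ( ≡-dec; map-upTo; map-∘; ++-assoc; ++-identityʳ; ++-cancelˡ; length-++; length-take; length-drop
        ; take++drop≡id; ∷-injectiveˡ; ∷-injectiveʳ)
open import Data.List.Relation.Unary.All as All using (All; []; _∷_; universal; universal-U)
open import Data.List.Relation.Unary.All.Properties using (tabulate⁺; map⁺; concat⁺)
open import Data.Product using (∃; _×_; _,_; proj₁; proj₂)
open import Data.Empty using (⊥-elim)
open import Data.Sum using (_⊎_; inj₁; inj₂; [_,_]′)
open import Relation.Binary using (tri<; tri≈; tri>)
open import Relation.Nullary.Decidable using (_×-dec_; _→-dec_)
open import Relation.Nullary using (Dec; yes; no; ¬_)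
open import Relation.Binary.PropositionalEquality
open +-*-Solver using (solve; _:=_; _:+_; _:*_; con)
open ≡-Reasoning

fromℤ : ℤ → ℚ
fromℤ z = z ÷ 1

fromℕ : ℕ → ℚ
fromℕ n = fromℤ (ℤ.+ n)

private
  toℚᵘ-fromℤ : ∀ z → toℚᵘ (fromℤ z) ℚᵘ.≃ ℚᵘ.mkℚᵘ z 0
  toℚᵘ-fromℤ z = toℚᵘ-fromℚᵘ (ℚᵘ.mkℚᵘ z 0)

fromℤ-+ : ∀ a b → fromℤ (a ℤ.+ b) ≡ fromℤ a + fromℤ b
fromℤ-+ a b = sym (toℚᵘ-injective (ℚᵘP.≃-trans (toℚᵘ-homo-+ (fromℤ a) (fromℤ b))
  (ℚᵘP.≃-trans (ℚᵘP.+-cong (toℚᵘ-fromℤ a) (toℚᵘ-fromℤ b))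
  (ℚᵘP.≃-trans (ℚᵘ.*≡* eq) (ℚᵘP.≃-sym (toℚᵘ-fromℤ (a ℤ.+ b)))))))
  where
  eq : (a ℤ.* ℤ.+ 1 ℤ.+ b ℤ.* ℤ.+ 1) ℤ.* ℤ.+ 1 ≡ (a ℤ.+ b) ℤ.* ℤ.+ 1
  eq = cong (ℤ._* ℤ.+ 1) (cong₂ ℤ._+_ (ℤP.*-identityʳ a) (ℤP.*-identityʳ b))

fromℤ-* : ∀ a b → fromℤ (a ℤ.* b) ≡ fromℤ a * fromℤ b
fromℤ-* a b = sym (toℚᵘ-injective (ℚᵘP.≃-trans (toℚᵘ-homo-* (fromℤ a) (fromℤ b))
  (ℚᵘP.≃-trans (ℚᵘP.*-cong (toℚᵘ-fromℤ a) (toℚᵘ-fromℤ b))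
  (ℚᵘP.≃-trans (ℚᵘ.*≡* refl) (ℚᵘP.≃-sym (toℚᵘ-fromℤ (a ℤ.* b)))))))

fromℕ-+ : ∀ m n → fromℕ (m ℕ.+ n) ≡ fromℕ m + fromℕ n
fromℕ-+ m n = trans (cong fromℤ (ℤP.pos-+ m n)) (fromℤ-+ (ℤ.+ m) (ℤ.+ n))

fromℕ-* : ∀ m n → fromℕ (m ℕ.* n) ≡ fromℕ m * fromℕ n
fromℕ-* m n = trans (cong fromℤ (ℤP.pos-* m n)) (fromℤ-* (ℤ.+ m) (ℤ.+ n))

fromℕ-inverseʳ : ∀ n .{{_ : ℕ.NonZero n}} → fromℕ n * (ℤ.+ 1 ÷ n) ≡ 1ℚ
fromℕ-inverseʳ (suc d) = toℚᵘ-injective (ℚᵘP.≃-trans (toℚᵘ-homo-* (fromℕ (suc d)) (ℤ.+ 1 ÷ suc d))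
  (ℚᵘP.≃-trans (ℚᵘP.*-cong (toℚᵘ-fromℤ (ℤ.+ suc d)) (toℚᵘ-fromℚᵘ (ℚᵘ.mkℚᵘ (ℤ.+ 1) d))) (ℚᵘ.*≡* eq)))
  where
  eq : (ℤ.+ suc d ℤ.* ℤ.+ 1) ℤ.* ℤ.+ 1 ≡ ℤ.+ 1 ℤ.* ℤ.+ (1 ℕ.* suc d)
  eq = trans (ℤP.*-identityʳ _) (trans (ℤP.*-identityʳ _)
         (sym (trans (ℤP.*-identityˡ _) (cong ℤ.+_ (ℕP.*-identityˡ (suc d))))))

fromℕ-cancelˡ : ∀ n .{{_ : ℕ.NonZero n}} {x y} → fromℕ n * x ≡ fromℕ n * y → x ≡ y
fromℕ-cancelˡ n {x} {y} eq = begin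
  x                           ≡⟨ sym (*-identityˡ x) ⟩
  1ℚ * x                      ≡⟨ cong (_* x) (sym (fromℕ-inverseʳ n)) ⟩
  fromℕ n * n⁻¹ * x           ≡⟨ solve 3 (λ a b x → a :* b :* x := b :* (a :* x)) refl (fromℕ n) n⁻¹ x ⟩
  n⁻¹ * (fromℕ n * x)         ≡⟨ cong (n⁻¹ *_) eq ⟩
  n⁻¹ * (fromℕ n * y)         ≡⟨ solve 3 (λ a b y → b :* (a :* y) := a :* b :* y) refl (fromℕ n) n⁻¹ y ⟩
  fromℕ n * n⁻¹ * y           ≡⟨ cong (_* y) (fromℕ-inverseʳ n) ⟩
  1ℚ * y                      ≡⟨ *-identityˡ y ⟩
  y                           ∎
  where
    n⁻¹ : ℚ
    n⁻¹ = ℤ.+ 1 ÷ n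

invFact : ℕ → ℚ
invFact m = (ℤ.+ 1 ÷ (m !)) {{m !≢0}}

fromℕ-suc*invFact-suc : ∀ m → fromℕ (suc m) * invFact (suc m) ≡ invFact m
fromℕ-suc*invFact-suc m = fromℕ-cancelˡ (m !) {{m !≢0}} (begin
  fromℕ (m !) * (fromℕ (suc m) * invFact (suc m)) ≡⟨ sym (*-assoc (fromℕ (m !)) _ _) ⟩
  fromℕ (m !) * fromℕ (suc m) * invFact (suc m)   ≡⟨ cong (_* invFact (suc m)) (sym (fromℕ-* (m !) (suc m))) ⟩
  fromℕ (m ! ℕ.* suc m) * invFact (suc m)         ≡⟨ cong (λ k → fromℕ k * invFact (suc m)) (ℕP.*-comm (m !) (suc m)) ⟩
  fromℕ (suc m !) * invFact (suc m)               ≡⟨ fromℕ-inverseʳ (suc m !) {{suc m !≢0}} ⟩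
  1ℚ                                              ≡⟨ sym (fromℕ-inverseʳ (m !) {{m !≢0}}) ⟩
  fromℕ (m !) * invFact m                         ∎)

IsInteger-+ : ∀ {p q} → IsInteger p → IsInteger q → IsInteger (p + q)
IsInteger-+ (a , refl) (b , refl) = a ℤ.+ b , sym (fromℤ-+ a b)

IsInteger-* : ∀ {p q} → IsInteger p → IsInteger q → IsInteger (p * q)
IsInteger-* (a , refl) (b , refl) = a ℤ.* b , sym (fromℤ-* a b)

IsInteger-0 : IsInteger 0ℚ
IsInteger-0 = ℤ.+ 0 , refl

IsInteger-1 : IsInteger 1ℚ
IsInteger-1 = ℤ.+ 1 , refl

IsInteger-^ : ∀ {x} → IsInteger x → ∀ m → IsInteger (x ^ℚ m)
IsInteger-^ p zero    = IsInteger-1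
IsInteger-^ p (suc m) = IsInteger-* p (IsInteger-^ p m)

∑ : ℕ → (ℕ → ℚ) → ℚ
∑ zero    f = 0ℚ
∑ (suc n) f = f 0 + ∑ n (λ i → f (suc i))

syntax ∑ n (λ i → e) = ∑[ i < n ] e

Σℚ-upTo : ∀ n f → Σℚ (map f (upTo n)) ≡ ∑ n f
Σℚ-upTo n f = trans (cong Σℚ (map-upTo f n)) (Σℚ-applyUpTo n f)
  where
  Σℚ-applyUpTo : ∀ n f → Σℚ (applyUpTo f n) ≡ ∑ n f
  Σℚ-applyUpTo zero    f = refl
  Σℚ-applyUpTo (suc n) f = cong (f 0 +_) (Σℚ-applyUpTo n (λ i → f (suc i)))

∑-cong : ∀ n {f g} → (∀ i → i < n → f i ≡ g i) → ∑ n f ≡ ∑ n g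
∑-cong zero    eq = refl
∑-cong (suc n) eq = cong₂ _+_ (eq 0 (s≤s z≤n)) (∑-cong n (λ i i<n → eq (suc i) (s≤s i<n)))

∑-zero : ∀ n {f} → (∀ i → i < n → f i ≡ 0ℚ) → ∑ n f ≡ 0ℚ
∑-zero zero    z = refl
∑-zero (suc n) z = trans (cong₂ _+_ (z 0 (s≤s z≤n)) (∑-zero n (λ i i<n → z (suc i) (s≤s i<n))))
                         (+-identityˡ 0ℚ)

∑-last : ∀ n f → ∑ (suc n) f ≡ ∑ n f + f n
∑-last zero    f = trans (+-identityʳ (f 0)) (sym (+-identityˡ (f 0)))
∑-last (suc n) f = trans (cong (f 0 +_) (∑-last n (λ i → f (suc i)))) (sym (+-assoc (f 0) _ _))

∑-++ : ∀ m n f → ∑ (m ℕ.+ n) f ≡ ∑ m f + ∑[ i < n ] f (m ℕ.+ i)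
∑-++ zero    n f = sym (+-identityˡ _)
∑-++ (suc m) n f = trans (cong (f 0 +_) (∑-++ m n (λ i → f (suc i)))) (sym (+-assoc (f 0) _ _))

∑-singleton : ∀ n {i₀} f → i₀ < n → (∀ i → i ≢ i₀ → f i ≡ 0ℚ) → ∑ n f ≡ f i₀
∑-singleton (suc n) {zero} f _ z =
  trans (cong (f 0 +_) (∑-zero n (λ i _ → z (suc i) (λ ())))) (+-identityʳ (f 0))
∑-singleton (suc n) {suc i₀} f (s≤s i₀<n) z = trans (cong (_+ ∑ n (λ i → f (suc i))) (z 0 (λ ())))
  (trans (+-identityˡ _) (∑-singleton n (λ i → f (suc i)) i₀<n (λ i i≢i₀ → z (suc i) (i≢i₀ ∘ ℕP.suc-injective))))

∑-const : ∀ n c → ∑[ _ < n ] c ≡ fromℕ n * c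
∑-const zero    c = sym (*-zeroˡ c)
∑-const (suc n) c = begin
  c + ∑[ _ < n ] c      ≡⟨ cong (c +_) (∑-const n c) ⟩
  c + fromℕ n * c       ≡⟨ solve 2 (λ c m → c :+ m :* c := (con 1ℚ :+ m) :* c) refl c (fromℕ n) ⟩
  (1ℚ + fromℕ n) * c    ≡⟨ cong (_* c) (sym (fromℕ-+ 1 n)) ⟩
  fromℕ (suc n) * c     ∎

∑-distrib-+ : ∀ n f g → ∑[ i < n ] (f i + g i) ≡ ∑ n f + ∑ n g
∑-distrib-+ zero    f g = sym (+-identityˡ 0ℚ)
∑-distrib-+ (suc n) f g = trans (cong ((f 0 + g 0) +_) (∑-distrib-+ n _ _))
  (solve 4 (λ a b c d → (a :+ b) :+ (c :+ d) := (a :+ c) :+ (b :+ d)) refl (f 0) (g 0) _ _)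

*-distribˡ-∑ : ∀ n c f → c * ∑ n f ≡ ∑[ i < n ] (c * f i)
*-distribˡ-∑ zero    c f = *-zeroʳ c
*-distribˡ-∑ (suc n) c f = trans (*-distribˡ-+ c (f 0) _) (cong (c * f 0 +_) (*-distribˡ-∑ n c _))

*-distribʳ-∑ : ∀ n c f → ∑ n f * c ≡ ∑[ i < n ] (f i * c)
*-distribʳ-∑ n c f = trans (*-comm _ c) (trans (*-distribˡ-∑ n c f) (∑-cong n (λ i _ → *-comm c (f i))))

∑-comm : ∀ m n (f : ℕ → ℕ → ℚ) → ∑[ i < m ] ∑ n (f i) ≡ ∑[ j < n ] ∑[ i < m ] f i j
∑-comm zero    n f = sym (∑-zero n (λ _ _ → refl))
∑-comm (suc m) n f = trans (cong (∑ n (f 0) +_) (∑-comm m n (λ i → f (suc i)))) (sym (∑-distrib-+ n _ _))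

∑-reverse : ∀ n f → ∑ (suc n) f ≡ ∑[ i < suc n ] f (n ∸ i)
∑-reverse zero    f = refl
∑-reverse (suc n) f = begin
  f 0 + ∑[ i < suc n ] f (suc i)               ≡⟨ cong (f 0 +_) (∑-reverse n (λ i → f (suc i))) ⟩
  f 0 + ∑[ i < suc n ] f (suc (n ∸ i))         ≡⟨ cong (f 0 +_) (∑-cong (suc n) (λ i i<sn →
                                                    cong f (sym (ℕP.+-∸-assoc 1 (ℕP.≤-pred i<sn))))) ⟩
  f 0 + ∑[ i < suc n ] f (suc n ∸ i)           ≡⟨ +-comm (f 0) _ ⟩
  ∑[ i < suc n ] f (suc n ∸ i) + f 0           ≡⟨ cong (λ k → ∑[ i < suc n ] f (suc n ∸ i) + f k) (sym (ℕP.n∸n≡0 (suc n))) ⟩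
  ∑[ i < suc n ] f (suc n ∸ i) + f (suc n ∸ suc n) ≡⟨ sym (∑-last (suc n) (λ i → f (suc n ∸ i))) ⟩
  ∑[ i < suc (suc n) ] f (suc n ∸ i)           ∎

∑-triangle : ∀ n (F : ℕ → ℕ → ℚ) →
  ∑[ i < suc n ] ∑ (suc i) (F i) ≡ ∑[ j < suc n ] ∑[ i < suc (n ∸ j) ] F (j ℕ.+ i) j
∑-triangle zero    F = refl
∑-triangle (suc n) F = begin
  ∑[ i < suc (suc n) ] ∑ (suc i) (F i)                 ≡⟨ ∑-last (suc n) (λ i → ∑ (suc i) (F i)) ⟩
  ∑[ i < suc n ] ∑ (suc i) (F i) + ∑ (suc (suc n)) (F (suc n))
    ≡⟨ cong₂ _+_ (∑-triangle n F) (∑-last (suc n) (F (suc n))) ⟩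
  Rows n + (∑ (suc n) (F (suc n)) + F (suc n) (suc n)) ≡⟨ sym (+-assoc (Rows n) _ _) ⟩
  Rows n + ∑ (suc n) (F (suc n)) + F (suc n) (suc n)
    ≡⟨ cong (_+ F (suc n) (suc n)) (sym (∑-distrib-+ (suc n) (λ j → ∑[ i < suc (n ∸ j) ] F (j ℕ.+ i) j) (F (suc n)))) ⟩
  ∑[ j < suc n ] (∑[ i < suc (n ∸ j) ] F (j ℕ.+ i) j + F (suc n) j) + F (suc n) (suc n)
    ≡⟨ cong₂ _+_ (∑-cong (suc n) extend) corner ⟩
  ∑[ j < suc n ] ∑[ i < suc (suc n ∸ j) ] F (j ℕ.+ i) j + ∑[ i < suc (suc n ∸ suc n) ] F (suc n ℕ.+ i) (suc n)
    ≡⟨ sym (∑-last (suc n) (λ j → ∑[ i < suc (suc n ∸ j) ] F (j ℕ.+ i) j)) ⟩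
  Rows (suc n)                                         ∎
  where
  Rows : ℕ → ℚ
  Rows m = ∑[ j < suc m ] ∑[ i < suc (m ∸ j) ] F (j ℕ.+ i) j
  extend : ∀ j → j < suc n →
    ∑[ i < suc (n ∸ j) ] F (j ℕ.+ i) j + F (suc n) j ≡ ∑[ i < suc (suc n ∸ j) ] F (j ℕ.+ i) j
  extend j j<sn = begin
    ∑[ i < suc (n ∸ j) ] F (j ℕ.+ i) j + F (suc n) j
      ≡⟨ cong (λ k → ∑[ i < suc (n ∸ j) ] F (j ℕ.+ i) j + F k j)
              (trans (cong suc (sym (ℕP.m+[n∸m]≡n j≤n))) (sym (ℕP.+-suc j (n ∸ j)))) ⟩
    ∑[ i < suc (n ∸ j) ] F (j ℕ.+ i) j + F (j ℕ.+ suc (n ∸ j)) j ≡⟨ sym (∑-last (suc (n ∸ j)) (λ i → F (j ℕ.+ i) j)) ⟩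
    ∑[ i < suc (suc (n ∸ j)) ] F (j ℕ.+ i) j
      ≡⟨ cong (λ k → ∑[ i < suc k ] F (j ℕ.+ i) j) (sym (ℕP.+-∸-assoc 1 j≤n)) ⟩
    ∑[ i < suc (suc n ∸ j) ] F (j ℕ.+ i) j                   ∎
    where
      j≤n : j ≤ n
      j≤n = ℕP.≤-pred j<sn
  corner : F (suc n) (suc n) ≡ ∑[ i < suc (suc n ∸ suc n) ] F (suc n ℕ.+ i) (suc n)
  corner rewrite ℕP.n∸n≡0 n | ℕP.+-identityʳ n = sym (+-identityʳ _)

∑L : ∀ {A : Set} → List A → (A → ℚ) → ℚ
∑L xs f = Σℚ (map f xs)

syntax ∑L xs (λ x → e) = ∑[ x ∈ xs ] e

∑L-cong : ∀ {A : Set} {P : A → Set} {xs f g} → All P xs → (∀ x → P x → f x ≡ g x) → ∑L xs f ≡ ∑L xs g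
∑L-cong []       eq = refl
∑L-cong (p ∷ ps) eq = cong₂ _+_ (eq _ p) (∑L-cong ps eq)

∑L-zero : ∀ {A : Set} {P : A → Set} {xs f} → All P xs → (∀ x → P x → f x ≡ 0ℚ) → ∑L xs f ≡ 0ℚ
∑L-zero []       z = refl
∑L-zero (p ∷ ps) z = trans (cong₂ _+_ (z _ p) (∑L-zero ps z)) (+-identityˡ 0ℚ)

∑L-distrib-+ : ∀ {A : Set} (xs : List A) (f g : A → ℚ) → ∑[ x ∈ xs ] (f x + g x) ≡ ∑L xs f + ∑L xs g
∑L-distrib-+ []       f g = sym (+-identityˡ 0ℚ)
∑L-distrib-+ (x ∷ xs) f g = trans (cong ((f x + g x) +_) (∑L-distrib-+ xs f g))
  (solve 4 (λ a b c d → (a :+ b) :+ (c :+ d) := (a :+ c) :+ (b :+ d)) refl (f x) (g x) (∑L xs f) (∑L xs g))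

∑L-comm : ∀ {A B : Set} (xs : List A) (ys : List B) (f : A → B → ℚ) →
  ∑[ x ∈ xs ] ∑L ys (f x) ≡ ∑[ y ∈ ys ] ∑[ x ∈ xs ] f x y
∑L-comm []       ys f = sym (∑L-zero (universal-U ys) (λ _ _ → refl))
∑L-comm (x ∷ xs) ys f = trans (cong (∑L ys (f x) +_) (∑L-comm xs ys f))
  (sym (∑L-distrib-+ ys (f x) (λ y → ∑[ x′ ∈ xs ] f x′ y)))

∑-∑L-comm : ∀ {B : Set} n (ys : List B) (f : ℕ → B → ℚ) → ∑[ i < n ] ∑L ys (f i) ≡ ∑[ y ∈ ys ] ∑[ i < n ] f i y
∑-∑L-comm zero    ys f = sym (∑L-zero (universal-U ys) (λ _ _ → refl))
∑-∑L-comm (suc n) ys f =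
  trans (cong (∑L ys (f 0) +_) (∑-∑L-comm n ys (λ i → f (suc i))))
        (sym (∑L-distrib-+ ys (f 0) (λ y → ∑[ i < n ] f (suc i) y)))

∑L-concatMap : ∀ {A B : Set} (g : A → List B) xs (f : B → ℚ) → ∑L (concatMap g xs) f ≡ ∑[ x ∈ xs ] ∑L (g x) f
∑L-concatMap g []       f = refl
∑L-concatMap g (x ∷ xs) f = trans (∑L-++ (g x) (concatMap g xs)) (cong (∑L (g x) f +_) (∑L-concatMap g xs f))
  where
  ∑L-++ : ∀ ys zs → ∑L (ys ++ zs) f ≡ ∑L ys f + ∑L zs f
  ∑L-++ []       zs = sym (+-identityˡ _)
  ∑L-++ (y ∷ ys) zs = trans (cong (f y +_) (∑L-++ ys zs)) (sym (+-assoc (f y) (∑L ys f) (∑L zs f)))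

∑L-map : ∀ {A B : Set} (g : A → B) xs (f : B → ℚ) → ∑L (map g xs) f ≡ ∑[ x ∈ xs ] f (g x)
∑L-map g xs f = cong Σℚ (sym (map-∘ xs))

∑L-tabulate-singleton : ∀ {A : Set} n (h : Fin n → A) (f : A → ℚ) b →
  (∀ a → a ≢ b → f (h a) ≡ 0ℚ) → ∑L (tabulate h) f ≡ f (h b)
∑L-tabulate-singleton (suc n) h f Fin.zero z =
  trans (cong (f (h Fin.zero) +_) (∑L-zero (tabulate⁺ (λ a → z (Fin.suc a) (λ ()))) (λ _ eq → eq)))
        (+-identityʳ _)
∑L-tabulate-singleton (suc n) h f (Fin.suc b) z =
  trans (cong (_+ ∑L (tabulate (h ∘ Fin.suc)) f) (z Fin.zero (λ ())))
  (trans (+-identityˡ _) (∑L-tabulate-singleton n (h ∘ Fin.suc) f b (λ a a≢b → z (Fin.suc a) (a≢b ∘ FinP.suc-injective))))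

⊛-def : ∀ f g n → (f ⊛ g) n ≡ ∑[ i < suc n ] (f i * g (n ∸ i))
⊛-def f g n = Σℚ-upTo (suc n) (λ i → f i * g (n ∸ i))

⊛-cong : ∀ {f f′ g g′} → f ≗ f′ → g ≗ g′ → f ⊛ g ≗ f′ ⊛ g′
⊛-cong {f} {f′} {g} {g′} f≗f′ g≗g′ n = begin
  (f ⊛ g) n                          ≡⟨ ⊛-def f g n ⟩
  ∑[ i < suc n ] (f i * g (n ∸ i))   ≡⟨ ∑-cong (suc n) (λ i _ → cong₂ _*_ (f≗f′ i) (g≗g′ (n ∸ i))) ⟩
  ∑[ i < suc n ] (f′ i * g′ (n ∸ i)) ≡⟨ sym (⊛-def f′ g′ n) ⟩
  (f′ ⊛ g′) n                        ∎

⊛-congˡ : ∀ {f f′} g → f ≗ f′ → f ⊛ g ≗ f′ ⊛ g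
⊛-congˡ {f} {f′} g f≗f′ = ⊛-cong {f} {f′} {g} {g} f≗f′ (λ _ → refl)

⊛-congʳ : ∀ f {g g′} → g ≗ g′ → f ⊛ g ≗ f ⊛ g′
⊛-congʳ f g≗g′ = ⊛-cong {f} {f} (λ _ → refl) g≗g′

⊛-comm : ∀ f g → f ⊛ g ≗ g ⊛ f
⊛-comm f g n = begin
  (f ⊛ g) n                                  ≡⟨ ⊛-def f g n ⟩
  ∑[ i < suc n ] (f i * g (n ∸ i))           ≡⟨ ∑-reverse n (λ i → f i * g (n ∸ i)) ⟩
  ∑[ i < suc n ] (f (n ∸ i) * g (n ∸ (n ∸ i))) ≡⟨ ∑-cong (suc n) (λ i i<sn →
    trans (*-comm (f (n ∸ i)) (g (n ∸ (n ∸ i)))) (cong (λ k → g k * f (n ∸ i)) (ℕP.m∸[m∸n]≡n (ℕP.≤-pred i<sn)))) ⟩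
  ∑[ i < suc n ] (g i * f (n ∸ i))           ≡⟨ sym (⊛-def g f n) ⟩
  (g ⊛ f) n                                  ∎

⊛-distribʳ-+ : ∀ f g h n → ((λ i → f i + g i) ⊛ h) n ≡ (f ⊛ h) n + (g ⊛ h) n
⊛-distribʳ-+ f g h n = begin
  ((λ i → f i + g i) ⊛ h) n                                  ≡⟨ ⊛-def (λ i → f i + g i) h n ⟩
  ∑[ i < suc n ] ((f i + g i) * h (n ∸ i))                   ≡⟨ ∑-cong (suc n) (λ i _ → *-distribʳ-+ (h (n ∸ i)) (f i) (g i)) ⟩
  ∑[ i < suc n ] (f i * h (n ∸ i) + g i * h (n ∸ i))         ≡⟨ ∑-distrib-+ (suc n) (λ i → f i * h (n ∸ i)) (λ i → g i * h (n ∸ i)) ⟩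
  ∑[ i < suc n ] (f i * h (n ∸ i)) + ∑[ i < suc n ] (g i * h (n ∸ i)) ≡⟨ sym (cong₂ _+_ (⊛-def f h n) (⊛-def g h n)) ⟩
  (f ⊛ h) n + (g ⊛ h) n                                      ∎

⊛-*ˡ : ∀ c f g n → ((λ i → c * f i) ⊛ g) n ≡ c * (f ⊛ g) n
⊛-*ˡ c f g n = begin
  ((λ i → c * f i) ⊛ g) n             ≡⟨ ⊛-def (λ i → c * f i) g n ⟩
  ∑[ i < suc n ] (c * f i * g (n ∸ i)) ≡⟨ ∑-cong (suc n) (λ i _ → *-assoc c (f i) (g (n ∸ i))) ⟩
  ∑[ i < suc n ] (c * (f i * g (n ∸ i))) ≡⟨ sym (*-distribˡ-∑ (suc n) c (λ i → f i * g (n ∸ i))) ⟩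
  c * ∑[ i < suc n ] (f i * g (n ∸ i)) ≡⟨ cong (c *_) (sym (⊛-def f g n)) ⟩
  c * (f ⊛ g) n                        ∎

⊛-*ʳ : ∀ c f g n → (f ⊛ (λ i → c * g i)) n ≡ c * (f ⊛ g) n
⊛-*ʳ c f g n = trans (⊛-comm f (λ i → c * g i) n) (trans (⊛-*ˡ c g f n) (cong (c *_) (⊛-comm g f n)))

⊛-assoc : ∀ f g h → (f ⊛ g) ⊛ h ≗ f ⊛ (g ⊛ h)
⊛-assoc f g h n = begin
  ((f ⊛ g) ⊛ h) n                                              ≡⟨ ⊛-def (f ⊛ g) h n ⟩
  ∑[ i < suc n ] ((f ⊛ g) i * h (n ∸ i))                       ≡⟨ ∑-cong (suc n) (λ i _ →
    trans (cong (_* h (n ∸ i)) (⊛-def f g i)) (*-distribʳ-∑ (suc i) (h (n ∸ i)) (λ j → f j * g (i ∸ j)))) ⟩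
  ∑[ i < suc n ] ∑[ j < suc i ] (f j * g (i ∸ j) * h (n ∸ i))  ≡⟨ ∑-triangle n (λ i j → f j * g (i ∸ j) * h (n ∸ i)) ⟩
  ∑[ j < suc n ] ∑[ i < suc (n ∸ j) ] (f j * g (j ℕ.+ i ∸ j) * h (n ∸ (j ℕ.+ i)))
    ≡⟨ ∑-cong (suc n) (λ j _ → column j) ⟩
  ∑[ j < suc n ] (f j * (g ⊛ h) (n ∸ j))                       ≡⟨ sym (⊛-def f (g ⊛ h) n) ⟩
  (f ⊛ (g ⊛ h)) n                                              ∎
  where
  column : ∀ j → ∑[ i < suc (n ∸ j) ] (f j * g (j ℕ.+ i ∸ j) * h (n ∸ (j ℕ.+ i))) ≡ f j * (g ⊛ h) (n ∸ j)
  column j = begin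
    ∑[ i < suc (n ∸ j) ] (f j * g (j ℕ.+ i ∸ j) * h (n ∸ (j ℕ.+ i))) ≡⟨ ∑-cong (suc (n ∸ j)) (λ i _ →
      trans (*-assoc (f j) (g (j ℕ.+ i ∸ j)) (h (n ∸ (j ℕ.+ i))))
            (cong₂ (λ a b → f j * (g a * h b)) (ℕP.m+n∸m≡n j i) (sym (ℕP.∸-+-assoc n j i)))) ⟩
    ∑[ i < suc (n ∸ j) ] (f j * (g i * h (n ∸ j ∸ i)))
      ≡⟨ sym (*-distribˡ-∑ (suc (n ∸ j)) (f j) (λ i → g i * h (n ∸ j ∸ i))) ⟩
    f j * ∑[ i < suc (n ∸ j) ] (g i * h (n ∸ j ∸ i))                  ≡⟨ cong (f j *_) (sym (⊛-def g h (n ∸ j))) ⟩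
    f j * (g ⊛ h) (n ∸ j)                                             ∎

⊛-∑ʳ : ∀ g K (h : ℕ → PS) n → (g ⊛ (λ j → ∑[ m < K ] h m j)) n ≡ ∑[ m < K ] (g ⊛ h m) n
⊛-∑ʳ g K h n = begin
  (g ⊛ (λ j → ∑[ m < K ] h m j)) n                     ≡⟨ ⊛-def g (λ j → ∑[ m < K ] h m j) n ⟩
  ∑[ i < suc n ] (g i * ∑[ m < K ] h m (n ∸ i))        ≡⟨ ∑-cong (suc n) (λ i _ → *-distribˡ-∑ K (g i) (λ m → h m (n ∸ i))) ⟩
  ∑[ i < suc n ] ∑[ m < K ] (g i * h m (n ∸ i))        ≡⟨ ∑-comm (suc n) K (λ i m → g i * h m (n ∸ i)) ⟩
  ∑[ m < K ] ∑[ i < suc n ] (g i * h m (n ∸ i))        ≡⟨ ∑-cong K (λ m _ → sym (⊛-def g (h m) n)) ⟩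
  ∑[ m < K ] (g ⊛ h m) n                               ∎

𝟙 : PS
𝟙 zero    = 1ℚ
𝟙 (suc _) = 0ℚ

IsInteger-∑ : ∀ n {f} → (∀ i → IsInteger (f i)) → IsInteger (∑ n f)
IsInteger-∑ zero    p = IsInteger-0
IsInteger-∑ (suc n) p = IsInteger-+ (p 0) (IsInteger-∑ n (λ i → p (suc i)))

IsInteger-⊛ : ∀ {f g} → (∀ i → IsInteger (f i)) → (∀ i → IsInteger (g i)) → ∀ n → IsInteger ((f ⊛ g) n)
IsInteger-⊛ {f} {g} pf pg n =
  subst IsInteger (sym (⊛-def f g n)) (IsInteger-∑ (suc n) (λ i → IsInteger-* (pf i) (pg (n ∸ i))))

-- D f = t f′.
D : PS → PS
D f n = fromℕ n * f n

D-⊛ : ∀ f g n → D (f ⊛ g) n ≡ (D f ⊛ g) n + (f ⊛ D g) n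
D-⊛ f g n = begin
  fromℕ n * (f ⊛ g) n                                   ≡⟨ cong (fromℕ n *_) (⊛-def f g n) ⟩
  fromℕ n * ∑[ i < suc n ] (f i * g (n ∸ i))            ≡⟨ *-distribˡ-∑ (suc n) (fromℕ n) (λ i → f i * g (n ∸ i)) ⟩
  ∑[ i < suc n ] (fromℕ n * (f i * g (n ∸ i)))          ≡⟨ ∑-cong (suc n) split ⟩
  ∑[ i < suc n ] (D f i * g (n ∸ i) + f i * D g (n ∸ i)) ≡⟨ ∑-distrib-+ (suc n) (λ i → D f i * g (n ∸ i)) (λ i → f i * D g (n ∸ i)) ⟩
  ∑[ i < suc n ] (D f i * g (n ∸ i)) + ∑[ i < suc n ] (f i * D g (n ∸ i)) ≡⟨ sym (cong₂ _+_ (⊛-def (D f) g n) (⊛-def f (D g) n)) ⟩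
  (D f ⊛ g) n + (f ⊛ D g) n                             ∎
  where
  split : ∀ i → i < suc n → fromℕ n * (f i * g (n ∸ i)) ≡ D f i * g (n ∸ i) + f i * D g (n ∸ i)
  split i i<sn = begin
    fromℕ n * (f i * g (n ∸ i))                 ≡⟨ cong (λ k → fromℕ k * (f i * g (n ∸ i))) (sym (ℕP.m+[n∸m]≡n (ℕP.≤-pred i<sn))) ⟩
    fromℕ (i ℕ.+ (n ∸ i)) * (f i * g (n ∸ i))   ≡⟨ cong (_* (f i * g (n ∸ i))) (fromℕ-+ i (n ∸ i)) ⟩
    (fromℕ i + fromℕ (n ∸ i)) * (f i * g (n ∸ i)) ≡⟨ solve 4 (λ a b x y → (a :+ b) :* (x :* y) := a :* x :* y :+ x :* (b :* y))
                                                     refl (fromℕ i) (fromℕ (n ∸ i)) (f i) (g (n ∸ i)) ⟩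
    D f i * g (n ∸ i) + f i * D g (n ∸ i)       ∎

LogDeriv : PS → PS → Set
LogDeriv z a = D z ≗ a ⊛ z

module _ (f : PS) (f₀≡0 : f 0 ≡ 0ℚ) where

  ^ps-vanish : ∀ m n → n < m → (f ^ps m) n ≡ 0ℚ
  ^ps-vanish (suc m) n (s≤s n≤m) =
    trans (⊛-def f (f ^ps m) n) (∑-zero (suc n) (λ i i<sn → term n n≤m i (ℕP.≤-pred i<sn)))
    where
    term : ∀ n → n ≤ m → ∀ i → i ≤ n → f i * (f ^ps m) (n ∸ i) ≡ 0ℚ
    term n _ zero _ = trans (cong (_* (f ^ps m) n) f₀≡0) (*-zeroˡ ((f ^ps m) n))
    term (suc n) sn≤m (suc i) (s≤s i≤n) =
      trans (cong (f (suc i) *_) (^ps-vanish m (n ∸ i) (ℕP.<-≤-trans (s≤s (ℕP.m∸n≤m n i)) sn≤m))) (*-zeroʳ (f (suc i)))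

  D-^ps : ∀ m n → D (f ^ps suc m) n ≡ fromℕ (suc m) * (D f ⊛ (f ^ps m)) n
  D-^ps zero n = begin
    D (f ⊛ (f ^ps 0)) n                    ≡⟨ D-⊛ f (f ^ps 0) n ⟩
    (D f ⊛ (f ^ps 0)) n + (f ⊛ D (f ^ps 0)) n ≡⟨ cong ((D f ⊛ (f ^ps 0)) n +_) (trans (⊛-congʳ f D𝟙≗0 n)
                                              (trans (⊛-*ʳ 0ℚ f (f ^ps 0) n) (*-zeroˡ ((f ⊛ (f ^ps 0)) n)))) ⟩
    (D f ⊛ (f ^ps 0)) n + 0ℚ               ≡⟨ +-identityʳ ((D f ⊛ (f ^ps 0)) n) ⟩
    (D f ⊛ (f ^ps 0)) n                    ≡⟨ sym (*-identityˡ ((D f ⊛ (f ^ps 0)) n)) ⟩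
    fromℕ 1 * (D f ⊛ (f ^ps 0)) n          ∎
    where
    D𝟙≗0 : D (f ^ps 0) ≗ λ i → 0ℚ * (f ^ps 0) i
    D𝟙≗0 zero    = refl
    D𝟙≗0 (suc i) = trans (*-zeroʳ (fromℕ (suc i))) (sym (*-zeroˡ 0ℚ))
  D-^ps (suc m) n = begin
    D (f ⊛ fᵐ⁺¹) n                            ≡⟨ D-⊛ f fᵐ⁺¹ n ⟩
    (D f ⊛ fᵐ⁺¹) n + (f ⊛ D fᵐ⁺¹) n           ≡⟨ cong ((D f ⊛ fᵐ⁺¹) n +_) chain ⟩
    (D f ⊛ fᵐ⁺¹) n + c * (D f ⊛ fᵐ⁺¹) n       ≡⟨ solve 2 (λ x c → x :+ c :* x := (con 1ℚ :+ c) :* x) refl ((D f ⊛ fᵐ⁺¹) n) c ⟩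
    (1ℚ + c) * (D f ⊛ fᵐ⁺¹) n                 ≡⟨ cong (_* (D f ⊛ fᵐ⁺¹) n) (sym (fromℕ-+ 1 (suc m))) ⟩
    fromℕ (suc (suc m)) * (D f ⊛ fᵐ⁺¹) n      ∎
    where
    fᵐ⁺¹ : PS
    fᵐ⁺¹ = f ^ps suc m
    c : ℚ
    c = fromℕ (suc m)
    chain : (f ⊛ D fᵐ⁺¹) n ≡ c * (D f ⊛ fᵐ⁺¹) n
    chain = begin
      (f ⊛ D fᵐ⁺¹) n                          ≡⟨ ⊛-congʳ f (D-^ps m) n ⟩
      (f ⊛ (λ i → c * (D f ⊛ (f ^ps m)) i)) n   ≡⟨ ⊛-*ʳ c f (D f ⊛ (f ^ps m)) n ⟩
      c * (f ⊛ (D f ⊛ (f ^ps m))) n             ≡⟨ cong (c *_) (sym (⊛-assoc f (D f) (f ^ps m) n)) ⟩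
      c * ((f ⊛ D f) ⊛ (f ^ps m)) n             ≡⟨ cong (c *_) (⊛-congˡ (f ^ps m) (⊛-comm f (D f)) n) ⟩
      c * ((D f ⊛ f) ⊛ (f ^ps m)) n             ≡⟨ cong (c *_) (⊛-assoc (D f) f (f ^ps m) n) ⟩
      c * (D f ⊛ fᵐ⁺¹) n                      ∎

  expTrunc : ℕ → PS
  expTrunc M n = ∑[ m < suc M ] ((f ^ps m) n * invFact m)

  -- f ^ps m has order ≥ m, so only the terms m ≤ n contribute to the n-th coefficient.
  expTrunc-stable : ∀ M n → n ≤ M → expTrunc M n ≡ expPS f n
  expTrunc-stable M n n≤M = begin
    expTrunc M n               ≡⟨ cong (λ k → expTrunc k n) (sym (ℕP.m∸n+n≡m n≤M)) ⟩
    expTrunc (M ∸ n ℕ.+ n) n   ≡⟨ vanishing-tail (M ∸ n) ⟩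
    expTrunc n n               ≡⟨ sym (Σℚ-upTo (suc n) (λ m → (f ^ps m) n * invFact m)) ⟩
    expPS f n                  ∎
    where
    vanishing-tail : ∀ k → expTrunc (k ℕ.+ n) n ≡ expTrunc n n
    vanishing-tail zero    = refl
    vanishing-tail (suc k) = begin
      expTrunc (suc k ℕ.+ n) n                  ≡⟨ ∑-last (suc (k ℕ.+ n)) (λ m → (f ^ps m) n * invFact m) ⟩
      expTrunc (k ℕ.+ n) n + (f ^ps suc (k ℕ.+ n)) n * invFact (suc (k ℕ.+ n))
        ≡⟨ cong (λ x → expTrunc (k ℕ.+ n) n + x * invFact (suc (k ℕ.+ n)))
                (^ps-vanish (suc (k ℕ.+ n)) n (s≤s (ℕP.m≤n+m n k))) ⟩
      expTrunc (k ℕ.+ n) n + 0ℚ * invFact (suc (k ℕ.+ n)) ≡⟨ cong (expTrunc (k ℕ.+ n) n +_) (*-zeroˡ (invFact (suc (k ℕ.+ n)))) ⟩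
      expTrunc (k ℕ.+ n) n + 0ℚ                 ≡⟨ +-identityʳ (expTrunc (k ℕ.+ n) n) ⟩
      expTrunc (k ℕ.+ n) n                      ≡⟨ vanishing-tail k ⟩
      expTrunc n n                              ∎

  D-f₀≡0 : D f 0 ≡ 0ℚ
  D-f₀≡0 = trans (cong (fromℕ 0 *_) f₀≡0) (*-zeroʳ (fromℕ 0))

  LogDeriv-expPS : LogDeriv (expPS f) (D f)
  LogDeriv-expPS zero = begin
    D (expPS f) 0            ≡⟨ *-zeroˡ (expPS f 0) ⟩
    0ℚ                       ≡⟨ sym (*-zeroˡ (expPS f 0)) ⟩
    0ℚ * expPS f 0           ≡⟨ cong (_* expPS f 0) (sym D-f₀≡0) ⟩
    D f 0 * expPS f 0        ≡⟨ sym (+-identityʳ (D f 0 * expPS f 0)) ⟩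
    (D f ⊛ expPS f) 0        ∎
  LogDeriv-expPS (suc n′) = begin
    D (expPS f) n                                   ≡⟨ cong (fromℕ n *_) (Σℚ-upTo (suc n) (λ m → (f ^ps m) n * invFact m)) ⟩
    fromℕ n * ((f ^ps 0) n * invFact 0 + ∑ n T)     ≡⟨ cong (λ x → fromℕ n * (x + ∑ n T)) (*-zeroˡ (invFact 0)) ⟩
    fromℕ n * (0ℚ + ∑ n T)                          ≡⟨ cong (fromℕ n *_) (+-identityˡ (∑ n T)) ⟩
    fromℕ n * ∑ n T                                 ≡⟨ *-distribˡ-∑ n (fromℕ n) T ⟩
    ∑[ m < n ] (fromℕ n * T m)                      ≡⟨ ∑-cong n (λ m _ → term m) ⟩
    ∑[ m < n ] (D f ⊛ (λ j → (f ^ps m) j * invFact m)) n ≡⟨ sym (⊛-∑ʳ (D f) n (λ m j → (f ^ps m) j * invFact m) n) ⟩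
    (D f ⊛ expTrunc n′) n                           ≡⟨ ⊛-def (D f) (expTrunc n′) n ⟩
    ∑[ i < suc n ] (D f i * expTrunc n′ (n ∸ i))    ≡⟨ ∑-cong (suc n) truncate ⟩
    ∑[ i < suc n ] (D f i * expPS f (n ∸ i))        ≡⟨ sym (⊛-def (D f) (expPS f) n) ⟩
    (D f ⊛ expPS f) n                               ∎
    where
    n : ℕ
    n = suc n′
    T : ℕ → ℚ
    T m = (f ^ps suc m) n * invFact (suc m)
    term : ∀ m → fromℕ n * T m ≡ (D f ⊛ (λ j → (f ^ps m) j * invFact m)) n
    term m = begin
      fromℕ n * ((f ^ps suc m) n * invFact (suc m))          ≡⟨ sym (*-assoc (fromℕ n) ((f ^ps suc m) n) (invFact (suc m))) ⟩
      D (f ^ps suc m) n * invFact (suc m)                     ≡⟨ cong (_* invFact (suc m)) (D-^ps m n) ⟩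
      fromℕ (suc m) * (D f ⊛ (f ^ps m)) n * invFact (suc m)
        ≡⟨ solve 3 (λ a x b → a :* x :* b := (a :* b) :* x) refl (fromℕ (suc m)) ((D f ⊛ (f ^ps m)) n) (invFact (suc m)) ⟩
      fromℕ (suc m) * invFact (suc m) * (D f ⊛ (f ^ps m)) n   ≡⟨ cong (_* (D f ⊛ (f ^ps m)) n) (fromℕ-suc*invFact-suc m) ⟩
      invFact m * (D f ⊛ (f ^ps m)) n                         ≡⟨ sym (⊛-*ʳ (invFact m) (D f) (f ^ps m) n) ⟩
      (D f ⊛ (λ j → invFact m * (f ^ps m) j)) n               ≡⟨ ⊛-congʳ (D f) (λ j → *-comm (invFact m) ((f ^ps m) j)) n ⟩
      (D f ⊛ (λ j → (f ^ps m) j * invFact m)) n               ∎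
    truncate : ∀ i → i < suc n → D f i * expTrunc n′ (n ∸ i) ≡ D f i * expPS f (n ∸ i)
    truncate zero    _ = begin
      D f 0 * expTrunc n′ n ≡⟨ cong (_* expTrunc n′ n) D-f₀≡0 ⟩
      0ℚ * expTrunc n′ n    ≡⟨ *-zeroˡ (expTrunc n′ n) ⟩
      0ℚ                    ≡⟨ sym (*-zeroˡ (expPS f n)) ⟩
      0ℚ * expPS f n        ≡⟨ cong (_* expPS f n) (sym D-f₀≡0) ⟩
      D f 0 * expPS f n     ∎
    truncate (suc i) _ = cong (D f (suc i) *_) (expTrunc-stable n′ (n′ ∸ i) (ℕP.m∸n≤m n′ i))

LogDeriv-𝟙 : LogDeriv 𝟙 (λ _ → 0ℚ)
LogDeriv-𝟙 n = trans (vanish n) (sym (trans (⊛-def (λ _ → 0ℚ) 𝟙 n) (∑-zero (suc n) (λ i _ → *-zeroˡ (𝟙 (n ∸ i))))))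
  where
  vanish : ∀ n → D 𝟙 n ≡ 0ℚ
  vanish zero    = *-zeroˡ 1ℚ
  vanish (suc n) = *-zeroʳ (fromℕ (suc n))

LogDeriv-⊛ : ∀ {F G a b} → LogDeriv F a → LogDeriv G b → LogDeriv (F ⊛ G) (λ i → a i + b i)
LogDeriv-⊛ {F} {G} {a} {b} F′ G′ n = begin
  D (F ⊛ G) n                              ≡⟨ D-⊛ F G n ⟩
  (D F ⊛ G) n + (F ⊛ D G) n                ≡⟨ cong₂ _+_ (⊛-congˡ G F′ n) (⊛-congʳ F G′ n) ⟩
  ((a ⊛ F) ⊛ G) n + (F ⊛ (b ⊛ G)) n        ≡⟨ cong₂ _+_ (⊛-assoc a F G n) (sym (⊛-assoc F b G n)) ⟩
  (a ⊛ (F ⊛ G)) n + ((F ⊛ b) ⊛ G) n        ≡⟨ cong ((a ⊛ (F ⊛ G)) n +_) (⊛-congˡ G (⊛-comm F b) n) ⟩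
  (a ⊛ (F ⊛ G)) n + ((b ⊛ F) ⊛ G) n        ≡⟨ cong ((a ⊛ (F ⊛ G)) n +_) (⊛-assoc b F G n) ⟩
  (a ⊛ (F ⊛ G)) n + (b ⊛ (F ⊛ G)) n        ≡⟨ sym (⊛-distribʳ-+ a b (F ⊛ G) n) ⟩
  ((λ i → a i + b i) ⊛ (F ⊛ G)) n          ∎

-- Comparing n z n = Σ_{0<i≤n} a i · z (n − i) for two solutions, by strong induction on n.
LogDeriv-unique : ∀ {z z′ a a′} N → LogDeriv z a → LogDeriv z′ a′ → z 0 ≡ z′ 0 → a 0 ≡ 0ℚ → a′ 0 ≡ 0ℚ →
  (∀ i → i ≤ N → a i ≡ a′ i) → ∀ n → n ≤ N → z n ≡ z′ n
LogDeriv-unique {z} {z′} {a} {a′} N z-log z′-log z₀≡z′₀ a₀≡0 a′₀≡0 a≡a′ n n≤N = go n n ℕP.≤-refl n≤N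
  where
  go : ∀ m n → n ≤ m → n ≤ N → z n ≡ z′ n
  go _       zero    _         _     = z₀≡z′₀
  go (suc m) (suc n) (s≤s n≤m) sn≤N = fromℕ-cancelˡ (suc n) (begin
    D z (suc n)                          ≡⟨ z-log (suc n) ⟩
    (a ⊛ z) (suc n)                      ≡⟨ ⊛-def a z (suc n) ⟩
    ∑[ i < suc (suc n) ] (a i * z (suc n ∸ i))   ≡⟨ ∑-cong (suc (suc n)) term ⟩
    ∑[ i < suc (suc n) ] (a′ i * z′ (suc n ∸ i)) ≡⟨ sym (⊛-def a′ z′ (suc n)) ⟩
    (a′ ⊛ z′) (suc n)                    ≡⟨ sym (z′-log (suc n)) ⟩
    D z′ (suc n)                         ∎)
    where
    term : ∀ i → i < suc (suc n) → a i * z (suc n ∸ i) ≡ a′ i * z′ (suc n ∸ i)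
    term zero    _ = trans (cong (_* z (suc n)) a₀≡0)
                      (trans (*-zeroˡ (z (suc n))) (sym (trans (cong (_* z′ (suc n)) a′₀≡0) (*-zeroˡ (z′ (suc n))))))
    term (suc i) (s≤s si≤sn) = cong₂ _*_ (a≡a′ (suc i) (ℕP.≤-trans si≤sn sn≤N))
      (go m (n ∸ i) (ℕP.≤-trans (ℕP.m∸n≤m n i) n≤m) (ℕP.≤-trans (ℕP.m∸n≤m n i) (ℕP.≤-trans (ℕP.n≤1+n n) sn≤N)))

∣-positive-quotient : ∀ {d n} → d ∣ n → 0 < n → ∃ λ q → n ≡ suc q ℕ.* d
∣-positive-quotient (divides zero    n≡0) 0<n = ⊥-elim (ℕP.<⇒≢ 0<n (sym n≡0))
∣-positive-quotient (divides (suc q) n≡)  _   = q , n≡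

^ℚ-+ : ∀ x a b → x ^ℚ (a ℕ.+ b) ≡ x ^ℚ a * x ^ℚ b
^ℚ-+ x zero    b = sym (*-identityˡ (x ^ℚ b))
^ℚ-+ x (suc a) b = trans (cong (x *_) (^ℚ-+ x a b)) (sym (*-assoc x (x ^ℚ a) (x ^ℚ b)))

∑-multiples : ∀ e (h : ℕ → ℚ) → (∀ i → ¬ (suc e ∣ i) → h i ≡ 0ℚ) →
  ∀ q → ∑ (suc (q ℕ.* suc e)) h ≡ ∑[ j < suc q ] h (j ℕ.* suc e)
∑-multiples e h h-vanish zero    = refl
∑-multiples e h h-vanish (suc q) = begin
  ∑ (suc (suc q ℕ.* E)) h                                  ≡⟨ cong (λ k → ∑ k h) (cong suc (ℕP.+-comm E (q ℕ.* E))) ⟩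
  ∑ (suc (q ℕ.* E) ℕ.+ E) h                                ≡⟨ ∑-++ (suc (q ℕ.* E)) E h ⟩
  ∑ (suc (q ℕ.* E)) h + ∑[ r < E ] h (suc (q ℕ.* E) ℕ.+ r)
    ≡⟨ cong₂ _+_ (∑-multiples e h h-vanish q) (∑-last e (λ r → h (suc (q ℕ.* E) ℕ.+ r))) ⟩
  Multiples + (∑[ r < e ] h (suc (q ℕ.* E) ℕ.+ r) + h (suc (q ℕ.* E) ℕ.+ e))
    ≡⟨ cong (λ s → Multiples + (s + h (suc (q ℕ.* E) ℕ.+ e))) (∑-zero e gap) ⟩
  Multiples + (0ℚ + h (suc (q ℕ.* E) ℕ.+ e))
    ≡⟨ cong (Multiples +_) (trans (+-identityˡ _) (cong h (cong suc (ℕP.+-comm (q ℕ.* E) e)))) ⟩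
  Multiples + h (suc q ℕ.* E)                              ≡⟨ sym (∑-last (suc q) (λ j → h (j ℕ.* E))) ⟩
  ∑[ j < suc (suc q) ] h (j ℕ.* E)                         ∎
  where
  E : ℕ
  E = suc e
  Multiples : ℚ
  Multiples = ∑[ j < suc q ] h (j ℕ.* E)
  gap : ∀ r → r < e → h (suc (q ℕ.* E) ℕ.+ r) ≡ 0ℚ
  gap r r<e = h-vanish _ (λ E∣ → ℕP.<⇒≱ (s≤s r<e)
    (∣⇒≤ (∣m+n∣m⇒∣n (subst (E ∣_) (sym (ℕP.+-suc (q ℕ.* E) r)) E∣) (n∣m*n q))))

-- geometric e x = 1/(1 − x t^(e+1)), whose logarithmic derivative is geometricLog e x.
module _ (e : ℕ) (x : ℚ) where

  private
    E : ℕ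
    E = suc e

  geometric : PS
  geometric n with E ∣? n
  ... | yes _ = x ^ℚ (n / E)
  ... | no  _ = 0ℚ

  geometricLog : PS
  geometricLog zero = 0ℚ
  geometricLog (suc n) with E ∣? suc n
  ... | yes _ = fromℕ E * x ^ℚ (suc n / E)
  ... | no  _ = 0ℚ

  geometric-multiple : ∀ q → geometric (q ℕ.* E) ≡ x ^ℚ q
  geometric-multiple q with E ∣? (q ℕ.* E)
  ... | yes _   = cong (x ^ℚ_) (m*n/n≡m q E)
  ... | no  E∤ = ⊥-elim (E∤ (n∣m*n q))

  geometric-∤ : ∀ n → ¬ (E ∣ n) → geometric n ≡ 0ℚ
  geometric-∤ n E∤n with E ∣? n
  ... | yes E∣n = ⊥-elim (E∤n E∣n)
  ... | no  _   = refl

  geometricLog-multiple : ∀ q → geometricLog (suc q ℕ.* E) ≡ fromℕ E * x ^ℚ (suc q)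
  geometricLog-multiple q with E ∣? (suc q ℕ.* E)
  ... | yes _   = cong (λ k → fromℕ E * x ^ℚ k) (m*n/n≡m (suc q) E)
  ... | no  E∤ = ⊥-elim (E∤ (n∣m*n (suc q)))

  geometricLog-∤ : ∀ n → ¬ (E ∣ n) → geometricLog n ≡ 0ℚ
  geometricLog-∤ zero    _   = refl
  geometricLog-∤ (suc n) E∤n with E ∣? suc n
  ... | yes E∣n = ⊥-elim (E∤n E∣n)
  ... | no  _   = refl

  LogDeriv-geometric-∤ : ∀ n → ¬ (E ∣ n) → D geometric n ≡ (geometricLog ⊛ geometric) n
  LogDeriv-geometric-∤ n E∤n = begin
    D geometric n                                       ≡⟨ cong (fromℕ n *_) (geometric-∤ n E∤n) ⟩
    fromℕ n * 0ℚ                                        ≡⟨ *-zeroʳ (fromℕ n) ⟩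
    0ℚ                                                  ≡⟨ sym (∑-zero (suc n) term) ⟩
    ∑[ i < suc n ] (geometricLog i * geometric (n ∸ i)) ≡⟨ sym (⊛-def geometricLog geometric n) ⟩
    (geometricLog ⊛ geometric) n                        ∎
    where
    -- E cannot divide both i and n − i.
    term : ∀ i → i < suc n → geometricLog i * geometric (n ∸ i) ≡ 0ℚ
    term i i<sn = by-divisibility (E ∣? i) (E ∣? (n ∸ i))
      where
      by-divisibility : Dec (E ∣ i) → Dec (E ∣ (n ∸ i)) → geometricLog i * geometric (n ∸ i) ≡ 0ℚ
      by-divisibility (no E∤i) _ =
        trans (cong (_* geometric (n ∸ i)) (geometricLog-∤ i E∤i)) (*-zeroˡ (geometric (n ∸ i)))
      by-divisibility (yes _) (no E∤n-i) =
        trans (cong (geometricLog i *_) (geometric-∤ (n ∸ i) E∤n-i)) (*-zeroʳ (geometricLog i))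
      by-divisibility (yes E∣i) (yes E∣n-i) =
        ⊥-elim (E∤n (subst (E ∣_) (ℕP.m+[n∸m]≡n (ℕP.≤-pred i<sn)) (∣m∣n⇒∣m+n E∣i E∣n-i)))

  LogDeriv-geometric-multiple : ∀ q → D geometric (q ℕ.* E) ≡ (geometricLog ⊛ geometric) (q ℕ.* E)
  LogDeriv-geometric-multiple q = sym (begin
    (geometricLog ⊛ geometric) (q ℕ.* E)                                   ≡⟨ ⊛-def geometricLog geometric (q ℕ.* E) ⟩
    ∑[ i < suc (q ℕ.* E) ] (geometricLog i * geometric (q ℕ.* E ∸ i))
      ≡⟨ ∑-multiples e (λ i → geometricLog i * geometric (q ℕ.* E ∸ i))
                       (λ i E∤i → trans (cong (_* geometric (q ℕ.* E ∸ i)) (geometricLog-∤ i E∤i))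
                                         (*-zeroˡ (geometric (q ℕ.* E ∸ i)))) q ⟩
    geometricLog 0 * geometric (q ℕ.* E ∸ 0) + ∑[ j < q ] Term (suc j)
      ≡⟨ cong (_+ ∑[ j < q ] Term (suc j)) (*-zeroˡ (geometric (q ℕ.* E))) ⟩
    0ℚ + ∑[ j < q ] Term (suc j)                                           ≡⟨ +-identityˡ (∑[ j < q ] Term (suc j)) ⟩
    ∑[ j < q ] Term (suc j)                                                ≡⟨ ∑-cong q term ⟩
    ∑[ _ < q ] (fromℕ E * x ^ℚ q)                                          ≡⟨ ∑-const q (fromℕ E * x ^ℚ q) ⟩
    fromℕ q * (fromℕ E * x ^ℚ q)                                           ≡⟨ sym (*-assoc (fromℕ q) (fromℕ E) (x ^ℚ q)) ⟩
    fromℕ q * fromℕ E * x ^ℚ q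
      ≡⟨ cong₂ _*_ (sym (fromℕ-* q E)) (sym (geometric-multiple q)) ⟩
    D geometric (q ℕ.* E)                                                  ∎)
    where
    Term : ℕ → ℚ
    Term j = geometricLog (j ℕ.* E) * geometric (q ℕ.* E ∸ j ℕ.* E)
    term : ∀ j → j < q → Term (suc j) ≡ fromℕ E * x ^ℚ q
    term j j<q = begin
      Term (suc j)
        ≡⟨ cong₂ _*_ (geometricLog-multiple j) (cong geometric (sym (ℕP.*-distribʳ-∸ E q (suc j)))) ⟩
      fromℕ E * x ^ℚ suc j * geometric ((q ∸ suc j) ℕ.* E) ≡⟨ cong (fromℕ E * x ^ℚ suc j *_) (geometric-multiple (q ∸ suc j)) ⟩
      fromℕ E * x ^ℚ suc j * x ^ℚ (q ∸ suc j)             ≡⟨ *-assoc (fromℕ E) (x ^ℚ suc j) (x ^ℚ (q ∸ suc j)) ⟩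
      fromℕ E * (x ^ℚ suc j * x ^ℚ (q ∸ suc j))           ≡⟨ cong (fromℕ E *_) (sym (^ℚ-+ x (suc j) (q ∸ suc j))) ⟩
      fromℕ E * x ^ℚ (suc j ℕ.+ (q ∸ suc j))              ≡⟨ cong (λ k → fromℕ E * x ^ℚ k) (ℕP.m+[n∸m]≡n j<q) ⟩
      fromℕ E * x ^ℚ q                                    ∎

  LogDeriv-geometric : LogDeriv geometric geometricLog
  LogDeriv-geometric n = by-divisibility (E ∣? n)
    where
    by-divisibility : Dec (E ∣ n) → D geometric n ≡ (geometricLog ⊛ geometric) n
    by-divisibility (no E∤n)             = LogDeriv-geometric-∤ n E∤n
    by-divisibility (yes (divides q refl)) = LogDeriv-geometric-multiple q

  geometric₀ : geometric 0 ≡ 1ℚ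
  geometric₀ = geometric-multiple 0

  IsInteger-geometric : IsInteger x → ∀ n → IsInteger (geometric n)
  IsInteger-geometric x∈ℤ n with E ∣? n
  ... | yes _ = IsInteger-^ x∈ℤ (n / E)
  ... | no  _ = IsInteger-0
geometricLog-zero : ∀ e n → 0 < n → geometricLog e 0ℚ n ≡ 0ℚ
geometricLog-zero e n 0<n = by-divisibility (suc e ∣? n)
  where
  by-divisibility : Dec (suc e ∣ n) → geometricLog e 0ℚ n ≡ 0ℚ
  by-divisibility (no E∤n) = geometricLog-∤ e 0ℚ n E∤n
  by-divisibility (yes (divides zero    refl)) = ⊥-elim (ℕP.<-irrefl refl 0<n)
  by-divisibility (yes (divides (suc q) refl)) = begin
    geometricLog e 0ℚ (suc q ℕ.* suc e) ≡⟨ geometricLog-multiple e 0ℚ q ⟩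
    fromℕ (suc e) * (0ℚ * 0ℚ ^ℚ q)     ≡⟨ cong (fromℕ (suc e) *_) (*-zeroˡ (0ℚ ^ℚ q)) ⟩
    fromℕ (suc e) * 0ℚ                 ≡⟨ *-zeroʳ (fromℕ (suc e)) ⟩
    0ℚ                                 ∎

geometricProduct : List (ℕ × ℚ) → PS
geometricProduct []            = 𝟙
geometricProduct ((e , x) ∷ L) = geometric e x ⊛ geometricProduct L

geometricProductLog : List (ℕ × ℚ) → PS
geometricProductLog L n = ∑[ p ∈ L ] geometricLog (proj₁ p) (proj₂ p) n

LogDeriv-geometricProduct : ∀ L → LogDeriv (geometricProduct L) (geometricProductLog L)
LogDeriv-geometricProduct []            = LogDeriv-𝟙
LogDeriv-geometricProduct ((e , x) ∷ L) =
  LogDeriv-⊛ {a = geometricLog e x} {b = geometricProductLog L} (LogDeriv-geometric e x) (LogDeriv-geometricProduct L)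

geometricProduct₀ : ∀ L → geometricProduct L 0 ≡ 1ℚ
geometricProduct₀ []            = refl
geometricProduct₀ ((e , x) ∷ L) = begin
  (geometric e x ⊛ geometricProduct L) 0       ≡⟨ ⊛-def (geometric e x) (geometricProduct L) 0 ⟩
  geometric e x 0 * geometricProduct L 0 + 0ℚ  ≡⟨ +-identityʳ (geometric e x 0 * geometricProduct L 0) ⟩
  geometric e x 0 * geometricProduct L 0       ≡⟨ cong₂ _*_ (geometric₀ e x) (geometricProduct₀ L) ⟩
  1ℚ * 1ℚ                                      ≡⟨ *-identityˡ 1ℚ ⟩
  1ℚ                                           ∎

geometricProductLog₀ : ∀ L → geometricProductLog L 0 ≡ 0ℚ
geometricProductLog₀ L = ∑L-zero (universal-U L) (λ _ _ → refl)

IsInteger-geometricProduct : ∀ L → All (IsInteger ∘ proj₂) L → ∀ n → IsInteger (geometricProduct L n)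
IsInteger-geometricProduct []            []       zero    = IsInteger-1
IsInteger-geometricProduct []            []       (suc n) = IsInteger-0
IsInteger-geometricProduct ((e , x) ∷ L) (x∈ℤ ∷ p) =
  IsInteger-⊛ (IsInteger-geometric e x x∈ℤ) (IsInteger-geometricProduct L p)

module _ {A : Set} where

  rot : List A → List A
  rot []      = []
  rot (a ∷ w) = w ++ a ∷ []

  rotate : ℕ → List A → List A
  rotate zero    w = w
  rotate (suc j) w = rotate j (rot w)

  length-rotate : ∀ j w → length (rotate j w) ≡ length w
  length-rotate zero    w       = refl
  length-rotate (suc j) []      = length-rotate j []
  length-rotate (suc j) (a ∷ w) = trans (length-rotate j (w ++ a ∷ [])) (trans (length-++ w) (ℕP.+-comm (length w) 1))

  rotate-[] : ∀ j → rotate j [] ≡ []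
  rotate-[] zero    = refl
  rotate-[] (suc j) = rotate-[] j

  rotate-+ : ∀ i j w → rotate (i ℕ.+ j) w ≡ rotate j (rotate i w)
  rotate-+ zero    j w = refl
  rotate-+ (suc i) j w = rotate-+ i j (rot w)

  rotate-++ : ∀ u v → rotate (length u) (u ++ v) ≡ v ++ u
  rotate-++ []      v = sym (++-identityʳ v)
  rotate-++ (a ∷ u) v = begin
    rotate (length u) ((u ++ v) ++ a ∷ []) ≡⟨ cong (rotate (length u)) (++-assoc u v (a ∷ [])) ⟩
    rotate (length u) (u ++ v ++ a ∷ [])   ≡⟨ rotate-++ u (v ++ a ∷ []) ⟩
    (v ++ a ∷ []) ++ u                     ≡⟨ ++-assoc v (a ∷ []) u ⟩
    v ++ a ∷ u                             ∎

  rotate-length : ∀ w → rotate (length w) w ≡ w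
  rotate-length w = trans (cong (rotate (length w)) (sym (++-identityʳ w))) (rotate-++ w [])

  rotate-inverse : ∀ j w → j ≤ length w → rotate (length w ∸ j) (rotate j w) ≡ w
  rotate-inverse j w j≤ = begin
    rotate (length w ∸ j) (rotate j w) ≡⟨ sym (rotate-+ j (length w ∸ j) w) ⟩
    rotate (j ℕ.+ (length w ∸ j)) w    ≡⟨ cong (λ t → rotate t w) (ℕP.m+[n∸m]≡n j≤) ⟩
    rotate (length w) w                ≡⟨ rotate-length w ⟩
    w                                  ∎

  rotate-* : ∀ d w → rotate d w ≡ w → ∀ q → rotate (q ℕ.* d) w ≡ w
  rotate-* d w period zero    = refl
  rotate-* d w period (suc q) = begin
    rotate (d ℕ.+ q ℕ.* d) w       ≡⟨ rotate-+ d (q ℕ.* d) w ⟩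
    rotate (q ℕ.* d) (rotate d w)  ≡⟨ cong (rotate (q ℕ.* d)) period ⟩
    rotate (q ℕ.* d) w             ≡⟨ rotate-* d w period q ⟩
    w                              ∎

  rotate-% : ∀ d .{{_ : ℕ.NonZero d}} w → rotate d w ≡ w → ∀ i → rotate i w ≡ rotate (i % d) w
  rotate-% d w period i = begin
    rotate i w                               ≡⟨ cong (λ t → rotate t w) (trans (m≡m%n+[m/n]*n i d) (ℕP.+-comm (i % d) _)) ⟩
    rotate (i / d ℕ.* d ℕ.+ i % d) w         ≡⟨ rotate-+ (i / d ℕ.* d) (i % d) w ⟩
    rotate (i % d) (rotate (i / d ℕ.* d) w)  ≡⟨ cong (rotate (i % d)) (rotate-* d w period (i / d)) ⟩
    rotate (i % d) w                         ∎

  rotate-comm : ∀ i j (w : List A) → rotate i (rotate j w) ≡ rotate j (rotate i w)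
  rotate-comm i j w = trans (sym (rotate-+ j i w)) (trans (cong (λ t → rotate t w) (ℕP.+-comm j i)) (rotate-+ i j w))

  rotate-≡⇒period : ∀ (w : List A) {i j} → i < j → j ≤ length w → rotate i w ≡ rotate j w → rotate (j ∸ i) w ≡ w
  rotate-≡⇒period w {i} {j} i<j j≤|w| eq = begin
    rotate (j ∸ i) w                                      ≡⟨ cong (rotate (j ∸ i)) (sym (rotate-inverse i w i≤|w|)) ⟩
    rotate (j ∸ i) (rotate (length w ∸ i) (rotate i w))   ≡⟨ rotate-comm (j ∸ i) (length w ∸ i) (rotate i w) ⟩
    rotate (length w ∸ i) (rotate (j ∸ i) (rotate i w))   ≡⟨ cong (rotate (length w ∸ i)) (sym (rotate-+ i (j ∸ i) w)) ⟩
    rotate (length w ∸ i) (rotate (i ℕ.+ (j ∸ i)) w)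
      ≡⟨ cong (λ t → rotate (length w ∸ i) (rotate t w)) (ℕP.m+[n∸m]≡n (ℕP.<⇒≤ i<j)) ⟩
    rotate (length w ∸ i) (rotate j w)                    ≡⟨ cong (rotate (length w ∸ i)) (sym eq) ⟩
    rotate (length w ∸ i) (rotate i w)                    ≡⟨ rotate-inverse i w i≤|w| ⟩
    w                                                     ∎
    where
      i≤|w| : i ≤ length w
      i≤|w| = ℕP.≤-trans (ℕP.<⇒≤ i<j) j≤|w|

  rotate-injective : ∀ (w : List A) {e} → e ≤ length w → (∀ {d} → 0 < d → d < e → rotate d w ≢ w) →
    ∀ {i j} → i < e → j < e → rotate i w ≡ rotate j w → i ≡ j
  rotate-injective w e≤|w| aperiodic {i} {j} i<e j<e eq with ℕP.<-cmp i j
  ... | tri≈ _ i≡j _ = i≡j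
  ... | tri< i<j _ _ = ⊥-elim (aperiodic (ℕP.m<n⇒0<n∸m i<j) (ℕP.≤-<-trans (ℕP.m∸n≤m j i) j<e)
                                 (rotate-≡⇒period w i<j (ℕP.≤-trans (ℕP.<⇒≤ j<e) e≤|w|) eq))
  ... | tri> _ _ j<i = ⊥-elim (aperiodic (ℕP.m<n⇒0<n∸m j<i) (ℕP.≤-<-trans (ℕP.m∸n≤m i j) i<e)
                                 (rotate-≡⇒period w j<i (ℕP.≤-trans (ℕP.<⇒≤ i<e) e≤|w|) (sym eq)))

  ++-≡-prefix : ∀ u v {x y : List A} → length u ≡ length v → u ++ x ≡ v ++ y → u ≡ v
  ++-≡-prefix []      []      _   _  = refl
  ++-≡-prefix (a ∷ u) (b ∷ v) |u|≡|v| eq =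
    cong₂ _∷_ (∷-injectiveˡ eq) (++-≡-prefix u v (ℕP.suc-injective |u|≡|v|) (∷-injectiveʳ eq))

module _ {k : ℕ} where

  length-^w : ∀ (l : Word k) q → length (l ^w q) ≡ q ℕ.* length l
  length-^w l zero    = refl
  length-^w l (suc q) = trans (length-++ l) (cong (length l ℕ.+_) (length-^w l q))

  rotate-^w-++ : ∀ (x y : Word k) q → rotate (length x) ((x ++ y) ^w q) ≡ (y ++ x) ^w q
  rotate-^w-++ x y zero    = rotate-[] (length x)
  rotate-^w-++ x y (suc q) = begin
    rotate (length x) ((x ++ y) ++ (x ++ y) ^w q) ≡⟨ cong (rotate (length x)) (++-assoc x y _) ⟩
    rotate (length x) (x ++ y ++ (x ++ y) ^w q)   ≡⟨ rotate-++ x _ ⟩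
    (y ++ (x ++ y) ^w q) ++ x                     ≡⟨ ++-assoc y _ x ⟩
    y ++ (x ++ y) ^w q ++ x                       ≡⟨ cong (y ++_) (shift q) ⟩
    y ++ x ++ (y ++ x) ^w q                       ≡⟨ sym (++-assoc y x _) ⟩
    (y ++ x) ++ (y ++ x) ^w q                     ∎
    where
    shift : ∀ q → (x ++ y) ^w q ++ x ≡ x ++ (y ++ x) ^w q
    shift zero    = sym (++-identityʳ x)
    shift (suc q) = begin
      ((x ++ y) ++ (x ++ y) ^w q) ++ x ≡⟨ ++-assoc (x ++ y) _ x ⟩
      (x ++ y) ++ (x ++ y) ^w q ++ x   ≡⟨ cong ((x ++ y) ++_) (shift q) ⟩
      (x ++ y) ++ x ++ (y ++ x) ^w q   ≡⟨ ++-assoc x y _ ⟩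
      x ++ y ++ x ++ (y ++ x) ^w q     ≡⟨ cong (x ++_) (sym (++-assoc y x _)) ⟩
      x ++ (y ++ x) ++ (y ++ x) ^w q   ∎

  rotate-^w : ∀ (l : Word k) b q → b ≤ length l → rotate b (l ^w q) ≡ rotate b l ^w q
  rotate-^w l b q b≤|l| = begin
    rotate b (l ^w q)               ≡⟨ cong₂ (λ t u → rotate t (u ^w q)) (sym |x|≡b) (sym (take++drop≡id b l)) ⟩
    rotate (length x) ((x ++ y) ^w q) ≡⟨ rotate-^w-++ x y q ⟩
    (y ++ x) ^w q                   ≡⟨ cong (_^w q) (sym (rotate-++ x y)) ⟩
    rotate (length x) (x ++ y) ^w q ≡⟨ cong₂ (λ t u → rotate t u ^w q) |x|≡b (take++drop≡id b l) ⟩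
    rotate b l ^w q                 ∎
    where
    x : Word k
    x = take b l
    y : Word k
    y = drop b l
    |x|≡b : length x ≡ b
    |x|≡b = trans (length-take b l) (ℕP.m≤n⇒m⊓n≡m b≤|l|)

  rotate-length-^w : ∀ (l : Word k) q → rotate (length l) (l ^w q) ≡ l ^w q
  rotate-length-^w l q = trans (rotate-^w l (length l) q ℕP.≤-refl) (cong (_^w q) (rotate-length l))

  ++-comm⇒^w : ∀ (l v : Word k) q → length v ≡ q ℕ.* length l → l ++ v ≡ v ++ l → v ≡ l ^w q
  ++-comm⇒^w l []      zero    _ _ = refl
  ++-comm⇒^w l (a ∷ v) zero    () _
  ++-comm⇒^w l v       (suc q) |v| comm = begin
    v        ≡⟨ v≡l++v′ ⟩
    l ++ v′  ≡⟨ cong (l ++_) (++-comm⇒^w l v′ q |v′| comm′) ⟩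
    l ++ l ^w q ∎
    where
    v′ : Word k
    v′ = drop (length l) v
    |l|≤|v| : length l ≤ length v
    |l|≤|v| = ℕP.≤-trans (ℕP.m≤m+n (length l) (q ℕ.* length l)) (ℕP.≤-reflexive (sym |v|))
    l≡prefix : l ≡ take (length l) v
    l≡prefix = ++-≡-prefix l (take (length l) v) (sym (trans (length-take (length l) v) (ℕP.m≤n⇒m⊓n≡m |l|≤|v|)))
      (trans comm (trans (cong (_++ l) (sym (take++drop≡id (length l) v))) (++-assoc (take (length l) v) v′ l)))
    v≡l++v′ : v ≡ l ++ v′
    v≡l++v′ = trans (sym (take++drop≡id (length l) v)) (cong (_++ v′) (sym l≡prefix))
    |v′| : length v′ ≡ q ℕ.* length l
    |v′| = trans (length-drop (length l) v) (trans (cong (_∸ length l) |v|) (ℕP.m+n∸m≡n (length l) _))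
    comm′ : l ++ v′ ≡ v′ ++ l
    comm′ = ++-cancelˡ l (l ++ v′) (v′ ++ l) (begin
      l ++ l ++ v′    ≡⟨ cong (l ++_) (sym v≡l++v′) ⟩
      l ++ v          ≡⟨ comm ⟩
      v ++ l          ≡⟨ cong (_++ l) v≡l++v′ ⟩
      (l ++ v′) ++ l  ≡⟨ ++-assoc l v′ l ⟩
      l ++ v′ ++ l    ∎)

module _ {P : ℕ → Set} (P? : ∀ i → Dec (P i)) where

  private
    search : ∀ n → (∃ λ m → m < n × P m × (∀ {i} → i < m → ¬ P i)) ⊎ (∀ {i} → i < n → ¬ P i)
    search zero = inj₂ (λ ())
    search (suc n) with search n
    ... | inj₁ (m , m<n , Pm , below) = inj₁ (m , ℕP.m<n⇒m<1+n m<n , Pm , below)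
    ... | inj₂ none with P? n
    ...   | yes Pn = inj₁ (n , ℕP.≤-refl , Pn , none)
    ...   | no ¬Pn = inj₂ (λ i<sn → [ none , (λ { refl → ¬Pn }) ]′ (ℕP.m≤n⇒m<n∨m≡n (ℕP.≤-pred i<sn)))

  least : ∀ {n} → P n → ∃ λ m → m ≤ n × P m × (∀ {i} → i < m → ¬ P i)
  least {n} Pn with search (suc n)
  ... | inj₁ (m , m<sn , Pm , below) = m , ℕP.≤-pred m<sn , Pm , below
  ... | inj₂ none                    = ⊥-elim (none ℕP.≤-refl Pn)

module _ {k : ℕ} where

  infix 4 _≺_ _≼_

  data _≺_ : Word k → Word k → Set where
    here  : ∀ {a b u v} → a Fin.< b → (a ∷ u) ≺ (b ∷ v)
    there : ∀ {a u v} → u ≺ v → (a ∷ u) ≺ (a ∷ v)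

  _≼_ : Word k → Word k → Set
  u ≼ v = u ≺ v ⊎ u ≡ v

  ≺-irrefl : ∀ {u} → ¬ (u ≺ u)
  ≺-irrefl (here a<a) = FinP.<-irrefl refl a<a
  ≺-irrefl (there u≺u) = ≺-irrefl u≺u

  ≺-trans : ∀ {u v w} → u ≺ v → v ≺ w → u ≺ w
  ≺-trans (here a<b)  (here b<c)  = here (FinP.<-trans a<b b<c)
  ≺-trans (here a<b)  (there _)   = here a<b
  ≺-trans (there _)   (here b<c)  = here b<c
  ≺-trans (there u≺v) (there v≺w) = there (≺-trans u≺v v≺w)

  ≺-≼-trans : ∀ {u v w} → u ≺ v → v ≼ w → u ≺ w
  ≺-≼-trans u≺v (inj₁ v≺w) = ≺-trans u≺v v≺w
  ≺-≼-trans u≺v (inj₂ refl) = u≺v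

  ≼-≺-trans : ∀ {u v w} → u ≼ v → v ≺ w → u ≺ w
  ≼-≺-trans (inj₁ u≺v) v≺w = ≺-trans u≺v v≺w
  ≼-≺-trans (inj₂ refl) v≺w = v≺w

  ≼-antisym : ∀ {u v} → u ≼ v → v ≼ u → u ≡ v
  ≼-antisym _           (inj₂ v≡u) = sym v≡u
  ≼-antisym (inj₂ u≡v)  _          = u≡v
  ≼-antisym (inj₁ u≺v)  (inj₁ v≺u) = ⊥-elim (≺-irrefl (≺-trans u≺v v≺u))

  ≺-++ : ∀ {u v} x y → u ≺ v → u ++ x ≺ v ++ y
  ≺-++ x y (here a<b)  = here a<b
  ≺-++ x y (there u≺v) = there (≺-++ x y u≺v)

  ≺-compare : ∀ u v → length u ≡ length v → u ≺ v ⊎ u ≡ v ⊎ v ≺ u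
  ≺-compare []      []      _ = inj₂ (inj₁ refl)
  ≺-compare (a ∷ u) (b ∷ v) |u|≡|v| with FinP.<-cmp a b
  ... | tri< a<b _ _ = inj₁ (here a<b)
  ... | tri> _ _ b<a = inj₂ (inj₂ (here b<a))
  ... | tri≈ _ refl _ with ≺-compare u v (ℕP.suc-injective |u|≡|v|)
  ...   | inj₁ u≺v         = inj₁ (there u≺v)
  ...   | inj₂ (inj₁ refl) = inj₂ (inj₁ refl)
  ...   | inj₂ (inj₂ v≺u)  = inj₂ (inj₂ (there v≺u))

  _≺?_ : ∀ u v → Dec (u ≺ v)
  []      ≺? _       = no λ ()
  (a ∷ u) ≺? []      = no λ ()
  (a ∷ u) ≺? (b ∷ v) with FinP.<-cmp a b
  ... | tri< a<b _ _   = yes (here a<b)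
  ... | tri> a≮b a≢b _ = no λ { (here a<b) → a≮b a<b ; (there _) → a≢b refl }
  ... | tri≈ a≮b refl _ with u ≺? v
  ...   | yes u≺v = yes (there u≺v)
  ...   | no  u⊀v = no λ { (here a<a) → a≮b a<a ; (there u≺v) → u⊀v u≺v }

  IsLyndon : Word k → Set
  IsLyndon l = ∀ {i} → i < length l → 0 < i → l ≺ rotate i l

  isLyndon? : ∀ l → Dec (IsLyndon l)
  isLyndon? l = ℕP.allUpTo? (λ i → (0 ℕ.<? i) →-dec (l ≺? rotate i l)) (length l)

  module _ {l : Word k} {e : ℕ} (lyndon : IsLyndon l) (|l|≡ : length l ≡ suc e) (q : ℕ) where

    private
      r : Word k
      r = l ^w suc q

    length-^w-Lyndon : length r ≡ suc q ℕ.* suc e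
    length-^w-Lyndon = trans (length-^w l (suc q)) (cong (suc q ℕ.*_) |l|≡)

    rotate-^w-Lyndon-period : rotate (suc e) r ≡ r
    rotate-^w-Lyndon-period = subst (λ t → rotate t r ≡ r) |l|≡ (rotate-length-^w l (suc q))

    ^w-Lyndon-≺-rotate : ∀ {i} → 0 < i → i < suc e → r ≺ rotate i r
    ^w-Lyndon-≺-rotate {i} 0<i i<e = subst (r ≺_) (sym (rotate-^w l i (suc q) i≤|l|))
      (≺-++ _ _ (lyndon (subst (i <_) (sym |l|≡) i<e) 0<i))
      where
        i≤|l| : i ≤ length l
        i≤|l| = subst (i ≤_) (sym |l|≡) (ℕP.<⇒≤ i<e)

    ^w-Lyndon-≼-rotate : ∀ i → r ≼ rotate i r
    ^w-Lyndon-≼-rotate i = subst (r ≼_) (sym (rotate-% (suc e) r rotate-^w-Lyndon-period i))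
      (below-period (i % suc e) (m%n<n i (suc e)))
      where
      below-period : ∀ b → b < suc e → r ≼ rotate b r
      below-period zero    _     = inj₂ refl
      below-period (suc b) sb<se = inj₁ (^w-Lyndon-≺-rotate (s≤s z≤n) sb<se)

    ^w-Lyndon-aperiodic : ∀ {i} → 0 < i → i < suc e → rotate i r ≢ r
    ^w-Lyndon-aperiodic 0<i i<e eq = ≺-irrefl (subst (r ≺_) eq (^w-Lyndon-≺-rotate 0<i i<e))

  least-rotations-≡ : ∀ {r s : Word k} {i j} → length r ≡ length s → i ≤ length r → j ≤ length s →
    (∀ t → r ≼ rotate t r) → (∀ t → s ≼ rotate t s) → rotate i r ≡ rotate j s → r ≡ s
  least-rotations-≡ {r} {s} {i} {j} |r|≡|s| i≤|r| j≤|s| r-least s-least eq =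
    ≼-antisym (subst (r ≼_) (sym s-from-r) (r-least (i ℕ.+ (length s ∸ j))))
              (subst (s ≼_) (sym r-from-s) (s-least (j ℕ.+ (length r ∸ i))))
    where
    r-from-s : r ≡ rotate (j ℕ.+ (length r ∸ i)) s
    r-from-s = begin
      r                                        ≡⟨ sym (rotate-inverse i r i≤|r|) ⟩
      rotate (length r ∸ i) (rotate i r)       ≡⟨ cong (rotate (length r ∸ i)) eq ⟩
      rotate (length r ∸ i) (rotate j s)       ≡⟨ sym (rotate-+ j (length r ∸ i) s) ⟩
      rotate (j ℕ.+ (length r ∸ i)) s          ∎
    s-from-r : s ≡ rotate (i ℕ.+ (length s ∸ j)) r
    s-from-r = begin
      s                                        ≡⟨ sym (rotate-inverse j s j≤|s|) ⟩
      rotate (length s ∸ j) (rotate j s)       ≡⟨ cong (rotate (length s ∸ j)) (sym eq) ⟩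
      rotate (length s ∸ j) (rotate i r)       ≡⟨ sym (rotate-+ i (length s ∸ j) r) ⟩
      rotate (i ℕ.+ (length s ∸ j)) r          ∎

  LyndonForm : ℕ → Word k → ℕ → Word k → Set
  LyndonForm e l j w =
    IsLyndon l × length l ≡ suc e × suc e ∣ length w × j < suc e × w ≡ rotate j (l ^w (length w / suc e))

  lyndonForm? : ∀ e l j w → Dec (LyndonForm e l j w)
  lyndonForm? e l j w = isLyndon? l ×-dec length l ℕ.≟ suc e ×-dec suc e ∣? length w ×-dec j ℕ.<? suc e
    ×-dec ≡-dec FinP._≟_ w (rotate j (l ^w (length w / suc e)))

  lyndonForm-power : ∀ {e l j w} → 0 < length w → LyndonForm e l j w →
    ∃ λ q → length w ≡ suc q ℕ.* suc e × w ≡ rotate j (l ^w suc q)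
  lyndonForm-power {e} {l} {j} 0<|w| (_ , _ , E∣|w| , _ , w≡) with ∣-positive-quotient E∣|w| 0<|w|
  ... | q , |w|≡ = q , |w|≡ , trans w≡ (cong (λ t → rotate j (l ^w t)) (trans (cong (_/ suc e) |w|≡) (m*n/n≡m (suc q) (suc e))))

  lyndonForm-unique : ∀ {w} → 0 < length w → ∀ {e l j f m i} →
    LyndonForm e l j w → LyndonForm f m i w → e ≡ f × l ≡ m × j ≡ i
  lyndonForm-unique {w} 0<|w| {e} {l} {j} {f} {m} {i}
    form₁@(l-lyndon , |l| , _ , j<e , _) form₂@(m-lyndon , |m| , _ , i<f , _)
    with lyndonForm-power 0<|w| form₁ | lyndonForm-power 0<|w| form₂
  ... | q , |w|≡qe , w≡rot-r | p , |w|≡pf , w≡rot-s = e≡f , l≡m , j≡i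
    where
    r : Word k
    r = l ^w suc q
    s : Word k
    s = m ^w suc p
    |r| : length r ≡ length w
    |r| = trans (length-^w-Lyndon l-lyndon |l| q) (sym |w|≡qe)
    |s| : length s ≡ length w
    |s| = trans (length-^w-Lyndon m-lyndon |m| p) (sym |w|≡pf)
    se≤|w| : suc e ≤ length w
    se≤|w| = subst (suc e ≤_) (sym |w|≡qe) (ℕP.m≤m+n (suc e) _)
    sf≤|w| : suc f ≤ length w
    sf≤|w| = subst (suc f ≤_) (sym |w|≡pf) (ℕP.m≤m+n (suc f) _)
    r≡s : r ≡ s
    r≡s = least-rotations-≡ (trans |r| (sym |s|))
      (subst (j ≤_) (sym |r|) (ℕP.≤-trans (ℕP.<⇒≤ j<e) se≤|w|))
      (subst (i ≤_) (sym |s|) (ℕP.≤-trans (ℕP.<⇒≤ i<f) sf≤|w|))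
      (^w-Lyndon-≼-rotate l-lyndon |l| q) (^w-Lyndon-≼-rotate m-lyndon |m| p) (trans (sym w≡rot-r) w≡rot-s)
    -- r ≡ s, so the least period of each power is a period of the other.
    se≡sf : suc e ≡ suc f
    se≡sf with ℕP.<-cmp (suc e) (suc f)
    ... | tri≈ _ eq _ = eq
    ... | tri< e<f _ _ = ⊥-elim (^w-Lyndon-aperiodic m-lyndon |m| p (s≤s z≤n) e<f
                           (subst (λ t → rotate (suc e) t ≡ t) r≡s (rotate-^w-Lyndon-period l-lyndon |l| q)))
    ... | tri> _ _ f<e = ⊥-elim (^w-Lyndon-aperiodic l-lyndon |l| q (s≤s z≤n) f<e
                           (subst (λ t → rotate (suc f) t ≡ t) (sym r≡s) (rotate-^w-Lyndon-period m-lyndon |m| p)))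
    e≡f : e ≡ f
    e≡f = ℕP.suc-injective se≡sf
    q≡p : suc q ≡ suc p
    q≡p = ℕP.*-cancelʳ-≡ (suc q) (suc p) (suc e) (trans (sym |w|≡qe) (trans |w|≡pf (cong (suc p ℕ.*_) (sym se≡sf))))
    l≡m : l ≡ m
    l≡m = ++-≡-prefix l m (trans |l| (trans se≡sf (sym |m|))) (trans r≡s (cong (m ^w_) (sym q≡p)))
    j≡i : j ≡ i
    j≡i = rotate-injective r (subst (suc e ≤_) (sym |r|) se≤|w|) (^w-Lyndon-aperiodic l-lyndon |l| q) j<e
      (subst (i <_) (sym se≡sf) i<f)
      (trans (sym w≡rot-r) (trans w≡rot-s (cong₂ (λ a b → rotate i (a ^w b)) (sym l≡m) (sym q≡p))))

  ≼-argmin : (f : ℕ → Word k) → (∀ i j → length (f i) ≡ length (f j)) → ∀ n →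
    ∃ λ m → m < suc n × (∀ {i} → i < suc n → f m ≼ f i)
  ≼-argmin f |f| zero = 0 , s≤s z≤n , λ { (s≤s z≤n) → inj₂ refl }
  ≼-argmin f |f| (suc n) with ≼-argmin f |f| n
  ... | m , m<sn , m-least with ≺-compare (f (suc n)) (f m) (|f| (suc n) m)
  ...   | inj₁ new≺m        = suc n , ℕP.≤-refl , λ i<ssn →
    [ (λ i<sn → inj₁ (≺-≼-trans new≺m (m-least i<sn))) , (λ { refl → inj₂ refl }) ]′ (ℕP.m<1+n⇒m<n∨m≡n i<ssn)
  ...   | inj₂ (inj₁ new≡m) = m , ℕP.m<n⇒m<1+n m<sn , λ i<ssn →
    [ m-least , (λ { refl → inj₂ (sym new≡m) }) ]′ (ℕP.m<1+n⇒m<n∨m≡n i<ssn)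
  ...   | inj₂ (inj₂ m≺new) = m , ℕP.m<n⇒m<1+n m<sn , λ i<ssn →
    [ m-least , (λ { refl → inj₁ m≺new }) ]′ (ℕP.m<1+n⇒m<n∨m≡n i<ssn)

  least-rotation : ∀ (w : Word k) → 0 < length w →
    ∃ λ i₀ → i₀ ≤ length w × (∀ t → rotate i₀ w ≼ rotate t (rotate i₀ w))
  least-rotation w@(a ∷ v) _
    with ≼-argmin (λ i → rotate i w) (λ i j → trans (length-rotate i w) (sym (length-rotate j w))) (length v)
  ... | i₀ , i₀<|w| , i₀-least = i₀ , ℕP.<⇒≤ i₀<|w| , λ t →
    subst (rotate i₀ w ≼_) (sym (rotated t)) (i₀-least (m%n<n (i₀ ℕ.+ t) (length w)))
    where
    rotated : ∀ t → rotate t (rotate i₀ w) ≡ rotate ((i₀ ℕ.+ t) % length w) w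
    rotated t = trans (sym (rotate-+ i₀ t w)) (rotate-% (length w) w (rotate-length w) (i₀ ℕ.+ t))

  -- The least rotation r is a power of its prefix l of length the least period of r, and l is Lyndon.
  least-rotation-Lyndon : ∀ (r : Word k) → 0 < length r → (∀ t → r ≼ rotate t r) →
    ∃ λ e → ∃ λ l → ∃ λ q → IsLyndon l × length l ≡ suc e × r ≡ l ^w suc q
  least-rotation-Lyndon r 0<|r| r-least
    with least (λ i → 0 ℕ.<? i ×-dec ≡-dec FinP._≟_ (rotate i r) r) {length r} (0<|r| , rotate-length r)
  ... | zero  , _    , (() , _)      , _
  ... | suc e , E≤|r| , (_ , period) , minimal = e , l , q , l-lyndon , |l| , r≡l^q
    where
    E : ℕ
    E = suc e
    no-shorter-period : ∀ x → x < E → rotate x r ≡ r → x ≡ 0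
    no-shorter-period zero    _    _ = refl
    no-shorter-period (suc x) sx<E p = ⊥-elim (minimal sx<E (s≤s z≤n , p))
    E∣|r| : E ∣ length r
    E∣|r| = m%n≡0⇒n∣m (length r) E (no-shorter-period (length r % E) (m%n<n (length r) E)
      (trans (sym (rotate-% E r period (length r))) (rotate-length r)))
    q : ℕ
    q = proj₁ (∣-positive-quotient E∣|r| 0<|r|)
    |r|≡ : length r ≡ suc q ℕ.* E
    |r|≡ = proj₂ (∣-positive-quotient E∣|r| 0<|r|)
    l : Word k
    l = take E r
    v : Word k
    v = drop E r
    |l| : length l ≡ E
    |l| = trans (length-take E r) (ℕP.m≤n⇒m⊓n≡m E≤|r|)
    l++v≡r : l ++ v ≡ r
    l++v≡r = take++drop≡id E r
    l++v≡v++l : l ++ v ≡ v ++ l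
    l++v≡v++l = begin
      l ++ v                  ≡⟨ l++v≡r ⟩
      r                       ≡⟨ sym period ⟩
      rotate E r              ≡⟨ cong₂ rotate (sym |l|) (sym l++v≡r) ⟩
      rotate (length l) (l ++ v) ≡⟨ rotate-++ l v ⟩
      v ++ l                  ∎
    |v| : length v ≡ q ℕ.* length l
    |v| = begin
      length v               ≡⟨ length-drop E r ⟩
      length r ∸ E           ≡⟨ cong (_∸ E) |r|≡ ⟩
      E ℕ.+ q ℕ.* E ∸ E      ≡⟨ ℕP.m+n∸m≡n E (q ℕ.* E) ⟩
      q ℕ.* E                ≡⟨ cong (q ℕ.*_) (sym |l|) ⟩
      q ℕ.* length l         ∎
    r≡l^q : r ≡ l ^w suc q
    r≡l^q = trans (sym l++v≡r) (cong (l ++_) (++-comm⇒^w l v q |v| l++v≡v++l))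
    rotate-r : ∀ {i} → i < length l → rotate i r ≡ rotate i l ^w suc q
    rotate-r {i} i<|l| = trans (cong (rotate i) r≡l^q) (rotate-^w l i (suc q) (ℕP.<⇒≤ i<|l|))
    l-lyndon : IsLyndon l
    l-lyndon {i} i<|l| 0<i with ≺-compare l (rotate i l) (sym (length-rotate i l))
    ... | inj₁ l≺rot         = l≺rot
    ... | inj₂ (inj₁ l≡rot)  = ⊥-elim (minimal (subst (i <_) |l| i<|l|)
      (0<i , trans (rotate-r i<|l|) (trans (cong (_^w suc q) (sym l≡rot)) (sym r≡l^q))))
    ... | inj₂ (inj₂ rot≺l)  = ⊥-elim (≺-irrefl (≼-≺-trans (r-least i)
      (subst₂ _≺_ (sym (rotate-r i<|l|)) (sym r≡l^q) (≺-++ _ _ rot≺l))))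

  lyndonForm-exists : ∀ (w : Word k) → 0 < length w → ∃ λ e → ∃ λ l → ∃ λ j → LyndonForm e l j w
  lyndonForm-exists w 0<|w| with least-rotation w 0<|w|
  ... | i₀ , i₀≤|w| , r-least
    with least-rotation-Lyndon (rotate i₀ w) (subst (0 <_) (sym (length-rotate i₀ w)) 0<|w|) r-least
  ... | e , l , q , l-lyndon , |l| , r≡l^q =
    e , l , j , l-lyndon , |l| , divides (suc q) |w|≡ , m%n<n (length w ∸ i₀) (suc e) , w≡
    where
    r : Word k
    r = rotate i₀ w
    j : ℕ
    j = (length w ∸ i₀) % suc e
    |w|≡ : length w ≡ suc q ℕ.* suc e
    |w|≡ = trans (sym (length-rotate i₀ w)) (trans (cong length r≡l^q) (length-^w-Lyndon l-lyndon |l| q))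
    period : rotate (suc e) r ≡ r
    period = subst (λ t → rotate (suc e) t ≡ t) (sym r≡l^q) (rotate-^w-Lyndon-period l-lyndon |l| q)
    w≡ : w ≡ rotate j (l ^w (length w / suc e))
    w≡ = begin
      w                                 ≡⟨ sym (rotate-inverse i₀ w i₀≤|w|) ⟩
      rotate (length w ∸ i₀) r          ≡⟨ rotate-% (suc e) r period (length w ∸ i₀) ⟩
      rotate j r                        ≡⟨ cong (rotate j) r≡l^q ⟩
      rotate j (l ^w suc q)
        ≡⟨ cong (λ t → rotate j (l ^w t)) (sym (trans (cong (_/ suc e) |w|≡) (m*n/n≡m (suc q) (suc e)))) ⟩
      rotate j (l ^w (length w / suc e)) ∎

module _ (k : ℕ) where

  All-length-wordsOfLength : ∀ n → All (λ w → length w ≡ n) (wordsOfLength k n)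
  All-length-wordsOfLength zero    = refl ∷ []
  All-length-wordsOfLength (suc n) =
    concat⁺ (map⁺ (universal (λ a → map⁺ (All.map (cong suc) (All-length-wordsOfLength n))) (allFin k)))

  ∑-wordsOfLength-singleton : ∀ n (v : Word k) → length v ≡ n → ∀ f →
    (∀ w → length w ≡ n → w ≢ v → f w ≡ 0ℚ) → ∑[ w ∈ wordsOfLength k n ] f w ≡ f v
  ∑-wordsOfLength-singleton zero    []      _     f _      = +-identityʳ (f [])
  ∑-wordsOfLength-singleton (suc n) (b ∷ v) |v|≡ f others = begin
    ∑L (wordsOfLength k (suc n)) f
      ≡⟨ ∑L-concatMap (λ a → map (a ∷_) (wordsOfLength k n)) (allFin k) f ⟩
    ∑[ a ∈ allFin k ] ∑L (map (a ∷_) (wordsOfLength k n)) f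
      ≡⟨ ∑L-cong (universal-U (allFin k)) (λ a _ → ∑L-map (a ∷_) (wordsOfLength k n) f) ⟩
    ∑[ a ∈ allFin k ] ∑[ u ∈ wordsOfLength k n ] f (a ∷ u)
      ≡⟨ ∑L-tabulate-singleton k (λ a → a) (λ a → ∑[ u ∈ wordsOfLength k n ] f (a ∷ u)) b other-letter ⟩
    ∑[ u ∈ wordsOfLength k n ] f (b ∷ u)
      ≡⟨ ∑-wordsOfLength-singleton n v (ℕP.suc-injective |v|≡) (λ u → f (b ∷ u))
           (λ u |u| u≢v → others (b ∷ u) (cong suc |u|) (u≢v ∘ ∷-injectiveʳ)) ⟩
    f (b ∷ v) ∎
    where
    other-letter : ∀ a → a ≢ b → ∑[ u ∈ wordsOfLength k n ] f (a ∷ u) ≡ 0ℚ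
    other-letter a a≢b = ∑L-zero (All-length-wordsOfLength n) (λ u |u| → others (a ∷ u) (cong suc |u|) (a≢b ∘ ∷-injectiveˡ))

[_]·_ : ∀ {P : Set} → Dec P → ℚ → ℚ
[ yes _ ]· x = x
[ no  _ ]· x = 0ℚ

[]·-yes : ∀ {P : Set} (P? : Dec P) x → P → [ P? ]· x ≡ x
[]·-yes (yes _) x _ = refl
[]·-yes (no ¬p) x p = ⊥-elim (¬p p)

[]·-no : ∀ {P : Set} (P? : Dec P) x → ¬ P → [ P? ]· x ≡ 0ℚ
[]·-no (yes p) x ¬p = ⊥-elim (¬p p)
[]·-no (no _)  x _  = refl

IsInteger-[]· : ∀ {P : Set} (P? : Dec P) {x} → IsInteger x → IsInteger ([ P? ]· x)
IsInteger-[]· (yes _) x∈ℤ = x∈ℤ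
IsInteger-[]· (no _)  _   = IsInteger-0

module _ {k : ℕ} (S : Series k) where

  private
    W : ℕ → List (Word k)
    W = wordsOfLength k

  lyndonValue : Word k → ℚ
  lyndonValue l = [ isLyndon? l ]· S l

  -- One factor 1/(1 − x t^(e+1)) for each word l of length e + 1 ≤ N: x = S l if l is Lyndon, else x = 0.
  lyndonFactors : ℕ → List (ℕ × ℚ)
  lyndonFactors N = concatMap (λ e → map (λ l → e , lyndonValue l) (W (suc e))) (upTo N)

  IsInteger-lyndonFactors : IntegerCoefficients S → ∀ N → All (IsInteger ∘ proj₂) (lyndonFactors N)
  IsInteger-lyndonFactors S∈ℤ N =
    concat⁺ (map⁺ (universal (λ e → map⁺ (universal (λ l → IsInteger-[]· (isLyndon? l) (S∈ℤ l)) (W (suc e)))) (upTo N)))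

  D-logZeta : ∀ n → D (logZeta S) (suc n) ≡ ∑[ w ∈ W (suc n) ] S w
  D-logZeta n = begin
    fromℕ (suc n) * (X * (ℤ.+ 1 ÷ suc n))
      ≡⟨ solve 3 (λ a x r → a :* (x :* r) := x :* (a :* r)) refl (fromℕ (suc n)) X (ℤ.+ 1 ÷ suc n) ⟩
    X * (fromℕ (suc n) * (ℤ.+ 1 ÷ suc n))  ≡⟨ cong (X *_) (fromℕ-inverseʳ (suc n)) ⟩
    X * 1ℚ                                 ≡⟨ *-identityʳ X ⟩
    X                                      ∎
    where
      X : ℚ
      X = ∑[ w ∈ W (suc n) ] S w

  module _ (cyclic : IsCyclic S) where

    private
      formValue : ℕ → Word k → ℕ → Word k → ℚ
      formValue e l j w = [ lyndonForm? e l j w ]· S w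

    S-rotate : ∀ j w → S (rotate j w) ≡ S w
    S-rotate zero    w       = refl
    S-rotate (suc j) []      = S-rotate j []
    S-rotate (suc j) (a ∷ w) = trans (S-rotate j (w ++ a ∷ [])) (sym (proj₁ cyclic (a ∷ []) w))

    S-^w : ∀ l → 0 < length l → ∀ q → S (l ^w suc q) ≡ S l ^ℚ suc q
    S-^w l _     zero    = trans (cong S (++-identityʳ l)) (sym (*-identityʳ (S l)))
    S-^w l 0<|l| (suc q) = proj₂ cyclic l 0<|l| (suc (suc q)) (s≤s (s≤s z≤n))

    -- For a Lyndon word l of length e + 1 dividing n, the words of length n in Lyndon form with root l
    -- are the e + 1 distinct rotations of a power of l, on which S takes the value (S l)^(n/(e+1)).
    ∑-rotations-of-power : ∀ n → 0 < n → ∀ e l → length l ≡ suc e →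
      ∑[ j < suc e ] ∑[ w ∈ W n ] formValue e l j w ≡ geometricLog e (lyndonValue l) n
    ∑-rotations-of-power n 0<n e l |l| = by-lyndon (isLyndon? l)
      where
      Total : ℚ
      Total = ∑[ j < suc e ] ∑[ w ∈ W n ] formValue e l j w
      no-forms : (∀ j w → length w ≡ n → ¬ LyndonForm e l j w) → Total ≡ 0ℚ
      no-forms none = ∑-zero (suc e) (λ j _ →
        ∑L-zero (All-length-wordsOfLength k n) (λ w |w| → []·-no (lyndonForm? e l j w) (S w) (none j w |w|)))
      by-lyndon : Dec (IsLyndon l) → Total ≡ geometricLog e (lyndonValue l) n
      by-lyndon (no ¬lyndon) = begin
        Total                             ≡⟨ no-forms (λ _ _ _ form → ¬lyndon (proj₁ form)) ⟩
        0ℚ                                ≡⟨ sym (geometricLog-zero e n 0<n) ⟩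
        geometricLog e 0ℚ n               ≡⟨ cong (λ x → geometricLog e x n) (sym ([]·-no (isLyndon? l) (S l) ¬lyndon)) ⟩
        geometricLog e (lyndonValue l) n  ∎
      by-lyndon (yes lyndon) = by-divisibility (suc e ∣? n)
        where
        by-divisibility : Dec (suc e ∣ n) → Total ≡ geometricLog e (lyndonValue l) n
        by-divisibility (no E∤n) =
          trans (no-forms (λ _ w |w| form → E∤n (subst (suc e ∣_) |w| (proj₁ (proj₂ (proj₂ form))))))
                (sym (geometricLog-∤ e (lyndonValue l) n E∤n))
        by-divisibility (yes E∣n) with ∣-positive-quotient E∣n 0<n
        ... | q , n≡ = begin
          Total                                              ≡⟨ ∑-cong (suc e) single ⟩
          ∑[ _ < suc e ] (S l ^ℚ suc q)                      ≡⟨ ∑-const (suc e) (S l ^ℚ suc q) ⟩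
          fromℕ (suc e) * S l ^ℚ suc q                       ≡⟨ cong (λ x → fromℕ (suc e) * x ^ℚ suc q)
                                                                 (sym ([]·-yes (isLyndon? l) (S l) lyndon)) ⟩
          fromℕ (suc e) * lyndonValue l ^ℚ suc q             ≡⟨ sym (geometricLog-multiple e (lyndonValue l) q) ⟩
          geometricLog e (lyndonValue l) (suc q ℕ.* suc e)   ≡⟨ cong (geometricLog e (lyndonValue l)) (sym n≡) ⟩
          geometricLog e (lyndonValue l) n                   ∎
          where
          n/E≡ : n / suc e ≡ suc q
          n/E≡ = trans (cong (_/ suc e) n≡) (m*n/n≡m (suc q) (suc e))
          single : ∀ j → j < suc e → ∑[ w ∈ W n ] formValue e l j w ≡ S l ^ℚ suc q
          single j j<E = begin
            ∑[ w ∈ W n ] formValue e l j w  ≡⟨ ∑-wordsOfLength-singleton k n v |v| (formValue e l j) other-word ⟩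
            formValue e l j v               ≡⟨ []·-yes (lyndonForm? e l j v) (S v)
                                                 (lyndon , |l| , subst (suc e ∣_) (sym |v|) E∣n , j<E ,
                                                cong (λ m → rotate j (l ^w (m / suc e))) (sym |v|)) ⟩
            S v                             ≡⟨ S-rotate j (l ^w (n / suc e)) ⟩
            S (l ^w (n / suc e))            ≡⟨ cong (λ m → S (l ^w m)) n/E≡ ⟩
            S (l ^w suc q)                  ≡⟨ S-^w l (subst (0 <_) (sym |l|) (s≤s z≤n)) q ⟩
            S l ^ℚ suc q                    ∎
            where
            v : Word k
            v = rotate j (l ^w (n / suc e))
            |v| : length v ≡ n
            |v| = trans (length-rotate j _) (trans (length-^w l (n / suc e))
                    (trans (cong ((n / suc e) ℕ.*_) |l|) (m/n*n≡m E∣n)))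
            other-word : ∀ w → length w ≡ n → w ≢ v → formValue e l j w ≡ 0ℚ
            other-word w |w| w≢v = []·-no (lyndonForm? e l j w) (S w)
              (λ form → w≢v (trans (proj₂ (proj₂ (proj₂ (proj₂ form)))) (cong (λ m → rotate j (l ^w (m / suc e))) |w|)))

    -- Every nonempty word has exactly one Lyndon form.
    ∑-lyndonForms : ∀ N w → 0 < length w → length w ≤ N →
      ∑[ e < N ] ∑[ l ∈ W (suc e) ] ∑[ j < suc e ] formValue e l j w ≡ S w
    ∑-lyndonForms N w 0<|w| |w|≤N with lyndonForm-exists w 0<|w|
    ... | e₀ , l₀ , j₀ , form₀@(_ , |l₀| , E₀∣|w| , j₀<E₀ , _) = begin
      ∑[ e < N ] ∑[ l ∈ W (suc e) ] ∑[ j < suc e ] formValue e l j w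
        ≡⟨ ∑-singleton N (λ e → ∑[ l ∈ W (suc e) ] ∑[ j < suc e ] formValue e l j w) e₀<N other-e ⟩
      ∑[ l ∈ W (suc e₀) ] ∑[ j < suc e₀ ] formValue e₀ l j w
        ≡⟨ ∑-wordsOfLength-singleton k (suc e₀) l₀ |l₀| (λ l → ∑[ j < suc e₀ ] formValue e₀ l j w) other-l ⟩
      ∑[ j < suc e₀ ] formValue e₀ l₀ j w   ≡⟨ ∑-singleton (suc e₀) (λ j → formValue e₀ l₀ j w) j₀<E₀ other-j ⟩
      formValue e₀ l₀ j₀ w                  ≡⟨ []·-yes (lyndonForm? e₀ l₀ j₀ w) (S w) form₀ ⟩
      S w                                   ∎
      where
      unique : ∀ {e l j} → LyndonForm e l j w → e ≡ e₀ × l ≡ l₀ × j ≡ j₀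
      unique form = lyndonForm-unique 0<|w| form form₀
      e₀<N : e₀ < N
      e₀<N = ℕP.≤-trans (∣⇒≤ {{ℕ.>-nonZero 0<|w|}} E₀∣|w|) |w|≤N
      other-e : ∀ e → e ≢ e₀ → ∑[ l ∈ W (suc e) ] ∑[ j < suc e ] formValue e l j w ≡ 0ℚ
      other-e e e≢e₀ = ∑L-zero (universal-U (W (suc e))) (λ l _ → ∑-zero (suc e) (λ j _ →
        []·-no (lyndonForm? e l j w) (S w) (e≢e₀ ∘ proj₁ ∘ unique)))
      other-l : ∀ l → length l ≡ suc e₀ → l ≢ l₀ → ∑[ j < suc e₀ ] formValue e₀ l j w ≡ 0ℚ
      other-l l _ l≢l₀ = ∑-zero (suc e₀) (λ j _ → []·-no (lyndonForm? e₀ l j w) (S w) (l≢l₀ ∘ proj₁ ∘ proj₂ ∘ unique))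
      other-j : ∀ j → j ≢ j₀ → formValue e₀ l₀ j w ≡ 0ℚ
      other-j j j≢j₀ = []·-no (lyndonForm? e₀ l₀ j w) (S w) (j≢j₀ ∘ proj₂ ∘ proj₂ ∘ unique)

    ∑-words≡geometricProductLog : ∀ N n → 0 < n → n ≤ N → ∑[ w ∈ W n ] S w ≡ geometricProductLog (lyndonFactors N) n
    ∑-words≡geometricProductLog N n 0<n n≤N = begin
      ∑[ w ∈ W n ] S w
        ≡⟨ ∑L-cong (All-length-wordsOfLength k n) (λ w |w| →
             sym (∑-lyndonForms N w (subst (0 <_) (sym |w|) 0<n) (subst (_≤ N) (sym |w|) n≤N))) ⟩
      ∑[ w ∈ W n ] ∑[ e < N ] ∑[ l ∈ W (suc e) ] ∑[ j < suc e ] formValue e l j w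
        ≡⟨ sym (∑-∑L-comm N (W n) (λ e w → ∑[ l ∈ W (suc e) ] ∑[ j < suc e ] formValue e l j w)) ⟩
      ∑[ e < N ] ∑[ w ∈ W n ] ∑[ l ∈ W (suc e) ] ∑[ j < suc e ] formValue e l j w
        ≡⟨ ∑-cong N (λ e _ → ∑L-comm (W n) (W (suc e)) (λ w l → ∑[ j < suc e ] formValue e l j w)) ⟩
      ∑[ e < N ] ∑[ l ∈ W (suc e) ] ∑[ w ∈ W n ] ∑[ j < suc e ] formValue e l j w
        ≡⟨ ∑-cong N (λ e _ → ∑L-cong (universal-U (W (suc e))) (λ l _ →
             sym (∑-∑L-comm (suc e) (W n) (λ j w → formValue e l j w)))) ⟩
      ∑[ e < N ] ∑[ l ∈ W (suc e) ] ∑[ j < suc e ] ∑[ w ∈ W n ] formValue e l j w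
        ≡⟨ ∑-cong N (λ e _ → ∑L-cong (All-length-wordsOfLength k (suc e)) (λ l |l| → ∑-rotations-of-power n 0<n e l |l|)) ⟩
      ∑[ e < N ] ∑[ l ∈ W (suc e) ] geometricLog e (lyndonValue l) n
        ≡⟨ ∑-cong N (λ e _ → sym (∑L-map (λ l → e , lyndonValue l) (W (suc e)) (λ p → geometricLog (proj₁ p) (proj₂ p) n))) ⟩
      ∑[ e < N ] ∑L (map (λ l → e , lyndonValue l) (W (suc e))) (λ p → geometricLog (proj₁ p) (proj₂ p) n)
        ≡⟨ sym (trans (∑L-concatMap (λ e → map (λ l → e , lyndonValue l) (W (suc e))) (upTo N) _) (Σℚ-upTo N _)) ⟩
      geometricProductLog (lyndonFactors N) n
        ∎

corollary2p3 : (k : ℕ) (S : Series k) → IsCyclic S → IntegerCoefficients S →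
    ∀ (n : ℕ) → IsInteger (zeta S n)
corollary2p3 k S cyclic S∈ℤ n =
  subst IsInteger (sym ζ≡product) (IsInteger-geometricProduct factors (IsInteger-lyndonFactors S S∈ℤ n) n)
  where
  factors : List (ℕ × ℚ)
  factors = lyndonFactors S n
  log-agrees : ∀ i → i ≤ n → D (logZeta S) i ≡ geometricProductLog factors i
  log-agrees zero    _    = sym (geometricProductLog₀ factors)
  log-agrees (suc i) si≤n = trans (D-logZeta S i) (∑-words≡geometricProductLog S cyclic n (suc i) (s≤s z≤n) si≤n)
  ζ≡product : zeta S n ≡ geometricProduct factors n
  ζ≡product = LogDeriv-unique n (LogDeriv-expPS (logZeta S) refl) (LogDeriv-geometricProduct factors)
    (sym (geometricProduct₀ factors)) refl (geometricProductLog₀ factors) log-agrees n ℕP.≤-refl
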